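{- Let $p$ be a prime, $G=\langle\sigma\rangle\simeq\mathbb{Z}/p^n\mathbb{Z}$, and $A$ a finite $\mathbb{F}_p[G]$-module with a decomposition $A=\bigoplus_{i=1}^{r}\mathbb{F}_p[G]\alpha_i$ into cyclic submodules. If $1\to A\to\hat G\xrightarrow{\varphi} G\to1$ is a group-theoretic embedding problem with kernel $A$, then there exists $\vec c\in\mathbb{F}_p^{r}$ such that $(\hat G,\varphi)$ is isomorphic, as a group-theoretic embedding problem over $G$, to $\mathfrak{G}(A,\vec c)$.
   Context: Modules are written additively; $\ell(\alpha)=\dim_{\mathbb{F}_p}\mathbb{F}_p[G]\alpha$. A group-theoretic embedding problem with kernel $A$ is a short exact sequence $1\to A\to\hat G\xrightarrow{\varphi}G\to1$ such that for every $\hat\tau\in\hat G$ and $a\in A$, $\hat\tau a\hat\tau^{ -1}=\varphi(\hat\tau)\cdot a$. Two such, $(\hat G_1,\varphi_1)$ and $(\hat G_2,\varphi_2)$, are isomorphic if there is a group isomorphism $\psi:\hat G_1\to\hat G_2$ with $\varphi_2\circ\psi=\varphi_1$. $\mathfrak{G}(A,\vec c)$ is the group generated by $\alpha_1,\dots,\alpha_r,\hat\sigma$ subject to: $\alpha_i\alpha_j=\alpha_j\alpha_i$; $\hat\sigma\alpha_i\hat\sigma^{ -1}=\sigma\cdot\alpha_i$; $(\sigma-1)^{\ell(\alpha_i)}\alpha_i=0$ (i.e., the relations of the $\mathbb{F}_p[G]$-module $A$, with the group law of $A$ being its addition); and $\hat\sigma^{p^n}=\sum_{i=1}^r c_i(\sigma-1)^{\ell(\alpha_i)-1}\alpha_i$;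 with $\varphi(\alpha_i)=1$, $\varphi(\hat\sigma)=\sigma$. -}

module Defs where

open import Level using (Level; 0ℓ; _⊔_) renaming (suc to lsuc)
open import Data.Nat using (ℕ; zero; suc; _+_; _*_; _∸_; _^_)
open import Data.Nat.Divisibility using (_∣_)
open import Data.Fin using (Fin; toℕ)
open import Data.Product using (Σ; ∃; _×_; _,_)
open import Algebra.Bundles using (Group; AbelianGroup; RawGroup)
open import Algebra.Morphism.Structures using (module GroupMorphisms)
import Algebra.Definitions.RawMonoid as RawMonoidDefs
open import Relation.Binary.Structures using (IsEquivalence)

iter : {A : Set} → ℕ → (A → A) → A → A
iter zero    f x = x
iter (suc k) f x = f (iter k f x)

-- congruence modulo m on ℕ:  a ≡ b (mod m)  iff  m ∣ |a - b|
-- (one of the two truncated differences is 0, which m always divides)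
ModEq : ℕ → ℕ → ℕ → Set
ModEq m a b = (m ∣ (a ∸ b)) × (m ∣ (b ∸ a))

-- The cyclic group G = ⟨σ⟩ ≃ ℤ/p^n is represented by ℕ modulo p^n
-- (k ↦ σ^k), with equality ModEq (p ^ n).
--
-- An F_p[G]-module, for G = ⟨σ⟩ cyclic of order p^n: an abelian group
-- (written with the bundle's ∙, ε, ⁻¹; "additive") of exponent p
-- (= an F_p-vector space) together with the action of the generator σ,
-- an additive map with σ^(p^n) = id (= a G-action by automorphisms).

record FpGModule (p n : ℕ) : Set₁ where
  field
    abGroup : AbelianGroup 0ℓ 0ℓ
  open AbelianGroup abGroup public
  open RawMonoidDefs rawMonoid public using (sum) renaming (_×_ to _⊗_)
  field
    σ       : Carrier → Carrier
    σ-cong  : ∀ {x y} → x ≈ y → σ x ≈ σ y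
    σ-hom   : ∀ x y → σ (x ∙ y) ≈ σ x ∙ σ y
    σ-order : ∀ x → iter (p ^ n) σ x ≈ x
    char-p  : ∀ x → p ⊗ x ≈ ε

module ModuleNotions {p n : ℕ} (M : FpGModule p n) where
  open FpGModule M

  σ^ : ℕ → Carrier → Carrier
  σ^ k = iter k σ

  δ : Carrier → Carrier
  δ a = σ a ∙ (a ⁻¹)

  δ^ : ℕ → Carrier → Carrier
  δ^ k = iter k δ

  -- action of f = Σ_{k < p^n} f_k σ^k ∈ F_p[G]  (coefficients read mod p)
  polyAct : (Fin (p ^ n) → ℕ) → Carrier → Carrier
  polyAct f a = sum (λ k → f k ⊗ σ^ (toℕ k) a)

  InCyclic : Carrier → Carrier → Set
  InCyclic α x = ∃ λ (f : Fin (p ^ n) → ℕ) → x ≈ polyAct f α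

  linComb : {k : ℕ} → (Fin k → Carrier) → (Fin k → ℕ) → Carrier
  linComb v c = sum (λ j → c j ⊗ v j)

  HasDim : (Carrier → Set) → ℕ → Set
  HasDim S k =
    Σ (Fin k → Carrier) λ v →
      (∀ j → S (v j)) ×
      (∀ x → S x → ∃ λ (c : Fin k → ℕ) → x ≈ linComb v c) ×
      (∀ (c : Fin k → ℕ) → linComb v c ≈ ε → ∀ j → p ∣ c j)

  IsFinite : Set
  IsFinite = Σ ℕ λ N → Σ (Fin N → Carrier) λ e → ∀ x → ∃ λ i → e i ≈ x

  IsCyclicDecomposition : (r : ℕ) → (Fin r → Carrier) → Set
  IsCyclicDecomposition r α =
    (∀ x → ∃ λ (xs : Fin r → Carrier) →
        (∀ i → InCyclic (α i) (xs i)) × x ≈ sum xs) ×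
    (∀ (xs ys : Fin r → Carrier) →
        (∀ i → InCyclic (α i) (xs i)) → (∀ i → InCyclic (α i) (ys i)) →
        sum xs ≈ sum ys → ∀ i → xs i ≈ ys i)

  record IsEmbeddingProblem {c ℓ : Level} (Ĝ : Group c ℓ)
           (ι : Carrier → Group.Carrier Ĝ) (φ : Group.Carrier Ĝ → ℕ)
           : Set (c ⊔ ℓ) where
    private module H = Group Ĝ
    open GroupMorphisms (AbelianGroup.rawGroup abGroup) H.rawGroup
    field
      ι-mono  : IsGroupMonomorphism ι
      φ-cong  : ∀ {x y} → x H.≈ y → ModEq (p ^ n) (φ x) (φ y)
      φ-hom   : ∀ x y → ModEq (p ^ n) (φ (x H.∙ y)) (φ x + φ y)
      φ-surj  : ∀ k → ∃ λ x → ModEq (p ^ n) (φ x) k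
      φ∘ι     : ∀ a → ModEq (p ^ n) (φ (ι a)) 0
      ker⊆im  : ∀ x → ModEq (p ^ n) (φ x) 0 → ∃ λ a → ι a H.≈ x
      conj    : ∀ τ a → (τ H.∙ ι a) H.∙ (τ H.⁻¹) H.≈ ι (σ^ (φ τ) a)

  -- The group 𝔊 presented by generators (elements of A, and σ̂) and
  -- relations: [a][b] = [a + b], σ̂ [a] σ̂⁻¹ = [σ a], σ̂^(p^n) = [z].
  -- Realised as words modulo the congruence generated by the group
  -- axioms and these relations (a setoid quotient).

  data Word : Set where
    gen  : Carrier → Word
    ŝ    : Word
    e    : Word
    _·_  : Word → Word → Word
    inv  : Word → Word

  ŝpow : ℕ → Word
  ŝpow zero    = e
  ŝpow (suc k) = ŝ · ŝpow k

  data _∼[_]_ : Word → Carrier → Word → Set where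
    ∼-refl   : ∀ {z x} → x ∼[ z ] x
    ∼-sym    : ∀ {z x y} → x ∼[ z ] y → y ∼[ z ] x
    ∼-trans  : ∀ {z x y w} → x ∼[ z ] y → y ∼[ z ] w → x ∼[ z ] w
    w-·-cong   : ∀ {z x x' y y'} → x ∼[ z ] x' → y ∼[ z ] y' → (x · y) ∼[ z ] (x' · y')
    w-inv-cong : ∀ {z x y} → x ∼[ z ] y → inv x ∼[ z ] inv y
    w-assoc    : ∀ {z} x y w → ((x · y) · w) ∼[ z ] (x · (y · w))
    w-idˡ      : ∀ {z} x → (e · x) ∼[ z ] x
    w-idʳ      : ∀ {z} x → (x · e) ∼[ z ] x
    w-invˡ     : ∀ {z} x → (inv x · x) ∼[ z ] e
    w-invʳ     : ∀ {z} x → (x · inv x) ∼[ z ] e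
    gen-cong : ∀ {z a b} → a ≈ b → gen a ∼[ z ] gen b
    gen-hom  : ∀ {z} a b → gen (a ∙ b) ∼[ z ] (gen a · gen b)
    conj-rel : ∀ {z} a → ((ŝ · gen a) · inv ŝ) ∼[ z ] gen (σ a)
    pow-rel  : ∀ {z} → ŝpow (p ^ n) ∼[ z ] gen z

  PresGroup : Carrier → Group 0ℓ 0ℓ
  PresGroup z = record
    { Carrier = Word
    ; _≈_ = λ x y → x ∼[ z ] y
    ; _∙_ = _·_
    ; ε = e
    ; _⁻¹ = inv
    ; isGroup = record
      { isMonoid = record
        { isSemigroup = record
          { isMagma = record
            { isEquivalence = record { refl = ∼-refl ; sym = ∼-sym ; trans = ∼-trans }
            ; ∙-cong = w-·-cong }
          ; assoc = w-assoc }
        ; identity = w-idˡ , w-idʳ }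
      ; inverse = w-invˡ , w-invʳ
      ; ⁻¹-cong = w-inv-cong }
    }

  -- the projection 𝔊 → G:  [a] ↦ 1 (i.e. 0),  σ̂ ↦ σ (i.e. 1)
  φPres : Word → ℕ
  φPres (gen a) = 0
  φPres ŝ       = 1
  φPres e       = 0
  φPres (x · y) = φPres x + φPres y
  φPres (inv x) = (p ^ n ∸ 1) * φPres x   -- = - φPres x  mod p^n

  zVec : {r : ℕ} → (Fin r → Carrier) → (Fin r → ℕ) → (Fin r → Fin p) → Carrier
  zVec α ℓ c = sum (λ i → toℕ (c i) ⊗ δ^ (ℓ i ∸ 1) (α i))

  𝔊 : {r : ℕ} → (Fin r → Carrier) → (Fin r → ℕ) → (Fin r → Fin p) → Group 0ℓ 0ℓ
  𝔊 α ℓ c = PresGroup (zVec α ℓ c)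

  IsoToPres : {c ℓ : Level} (Ĝ : Group c ℓ) (φ : Group.Carrier Ĝ → ℕ) → Carrier → Set (c ⊔ ℓ)
  IsoToPres Ĝ φ z =
    Σ (Group.Carrier Ĝ → Word) λ ψ →
      GroupMorphisms.IsGroupIsomorphism (Group.rawGroup Ĝ) (Group.rawGroup (PresGroup z)) ψ ×
      (∀ x → ModEq (p ^ n) (φPres (ψ x)) (φ x))

{-# OPTIONS --safe #-}

-- Choose a lift s ∈ Ĝ of σ. Then s^(p^n) lies in ker φ = ι(A), say s^(p^n) = ι(a₀), and a₀ is fixed
-- by σ because s commutes with its own power. In characteristic p, (σ − 1)^(p^n) = σ^(p^n) − 1 = 0,
-- so in a cyclic summand F_p[G]α the vectors (σ − 1)^j α below the nilpotency index form a basis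
-- (its size is ℓ(α) by the Steinitz exchange lemma) on which σ − 1 acts as a shift. Hence the
-- σ-fixed vectors of F_p[G]α are the multiples of (σ − 1)^(ℓ(α) − 1) α, and a₀ = Σ cᵢ (σ − 1)^(ℓ(αᵢ) − 1) αᵢ.
-- Sending σ̂ to s respects the relations of 𝔊(A, c), and the resulting map is bijective: every word
-- equals some [a] σ̂^k with k < p^n, and φ recovers k while the injectivity of ι recovers a.

module Submission where

open import Defs
open import Level using (Level; 0ℓ)
open import Data.Nat
open import Data.Nat.Properties
open import Data.Nat.Divisibility
open import Data.Nat.Primality
open import Data.Nat.Coprimality using (Coprime; coprime-Bézout)
open import Data.Nat.GCD using (module Bézout)
open import Data.Nat.Combinatorics using (_C_; nCn≡1; k>n⇒nCk≡0; nCk+nC[k+1]≡[n+1]C[k+1]; k![n∸k]!∣n!; nCk≡n!/k![n-k]!)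
open import Data.Nat.DivMod using (_%_; _/_; m/n*n≡m; m≡m%n+[m/n]*n; m%n<n; [m+kn]%n≡m%n; m<n⇒m%n≡m)
open import Data.Nat.Induction using (<-rec)
open import Data.Nat.Tactic.RingSolver using (solve-∀)
open import Data.Fin using (Fin; toℕ; fromℕ<)
open import Data.Fin.Properties using (fromℕ<-toℕ; toℕ<n; toℕ-fromℕ<; all?)
open import Data.Product using (∃; ∃₂; _,_; _×_; proj₁; proj₂)
open import Data.Sum using (_⊎_; inj₁; inj₂; [_,_]′)
open import Data.Empty using (⊥-elim)
open import Function using (_∘_; _$_; id)
open import Relation.Binary.PropositionalEquality as ≡ using (_≡_; _≢_; module ≡-Reasoning)
open import Relation.Binary.Bundles using (Setoid)
open import Relation.Binary.Structures using (IsEquivalence)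
open import Relation.Binary.Definitions using (tri<; tri≈; tri>)
import Relation.Binary.Reasoning.Setoid as SetoidReasoning
open import Relation.Nullary using (¬_; yes; no; Dec)
open import Relation.Nullary.Decidable using (¬?; decidable-stable)
open import Relation.Unary using (Decidable)
open import Algebra.Bundles using (AbelianGroup; Group)
open import Algebra.Morphism.Structures using (module GroupMorphisms)

∀<⊎∃¬ : {P : ℕ → Set} → Decidable P → ∀ K → (∀ i → i < K → P i) ⊎ ∃ λ i → i < K × ¬ P i
∀<⊎∃¬ P? K with anyUpTo? (¬? ∘ P?) K
... | yes counterexample = inj₂ counterexample
... | no none = inj₁ λ i i<K → decidable-stable (P? i) (λ ¬Pi → none (i , i<K , ¬Pi))

least-below : {P : ℕ → Set} → Decidable P → ∀ K →
              (∃ λ m → m < K × P m × ∀ j → j < m → ¬ P j) ⊎ (∀ j → j < K → ¬ P j)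
least-below P? zero = inj₂ λ _ ()
least-below P? (suc K) with least-below P? K
... | inj₁ (m , m<K , Pm , minimal) = inj₁ (m , m≤n⇒m≤1+n m<K , Pm , minimal)
... | inj₂ none with P? K
...   | yes PK = inj₁ (K , ≤-refl , PK , none)
...   | no ¬PK = inj₂ λ j j<1+K → [ none j , (λ { ≡.refl → ¬PK }) ]′ (m≤n⇒m<n∨m≡n (≤-pred j<1+K))

least : {P : ℕ → Set} → Decidable P → ∀ {K} → P K → ∃ λ m → P m × ∀ j → j < m → ¬ P j
least P? {K} PK with least-below P? (suc K)
... | inj₁ (m , _ , Pm , minimal) = m , Pm , minimal
... | inj₂ none = ⊥-elim (none K ≤-refl PK)

extend : {A : Set} {k : ℕ} → A → (Fin k → A) → ℕ → A
extend {k = k} d f j with j <? k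
... | yes j<k = f (fromℕ< j<k)
... | no  _   = d

extend-toℕ : {A : Set} {k : ℕ} (d : A) (f : Fin k → A) (j : Fin k) → extend d f (toℕ j) ≡ f j
extend-toℕ {k = k} d f j with toℕ j <? k
... | yes j<k = ≡.cong f (fromℕ<-toℕ j j<k)
... | no  j≮k = ⊥-elim (j≮k (toℕ<n j))

extend-preserves : {A : Set} {k : ℕ} (P : A → Set) {d : A} {f : Fin k → A} →
                   P d → (∀ i → P (f i)) → ∀ j → P (extend d f j)
extend-preserves {k = k} P Pd Pf j with j <? k
... | yes j<k = Pf (fromℕ< j<k)
... | no  _   = Pd

Σℕ : ℕ → (ℕ → ℕ) → ℕ
Σℕ zero    f = 0
Σℕ (suc k) f = f 0 + Σℕ k (f ∘ suc)

Σℕ-cong : ∀ k {f g} → (∀ i → i < k → f i ≡ g i) → Σℕ k f ≡ Σℕ k g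
Σℕ-cong zero    f≡g = ≡.refl
Σℕ-cong (suc k) f≡g = ≡.cong₂ _+_ (f≡g 0 z<s) (Σℕ-cong k (λ i i<k → f≡g (suc i) (s<s i<k)))

Σℕ-+ : ∀ k f g → Σℕ k (λ j → f j + g j) ≡ Σℕ k f + Σℕ k g
Σℕ-+ zero    f g = ≡.refl
Σℕ-+ (suc k) f g = ≡.trans (≡.cong (f 0 + g 0 +_) (Σℕ-+ k _ _)) (+-interchange (f 0) _ _ _)
  where
  +-interchange : ∀ a b c d → a + b + (c + d) ≡ a + c + (b + d)
  +-interchange = solve-∀

Σℕ-zero : ∀ k → Σℕ k (λ _ → 0) ≡ 0
Σℕ-zero zero    = ≡.refl
Σℕ-zero (suc k) = Σℕ-zero k

*-Σℕ : ∀ k c f → c * Σℕ k f ≡ Σℕ k (λ j → c * f j)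
*-Σℕ zero    c f = *-zeroʳ c
*-Σℕ (suc k) c f = ≡.trans (*-distribˡ-+ c (f 0) _) (≡.cong (c * f 0 +_) (*-Σℕ k c _))

skip : ℕ → ℕ → ℕ
skip i₀ i with i <? i₀
... | yes _ = i
... | no  _ = suc i

skip-< : ∀ {i₀ i} → i < i₀ → skip i₀ i ≡ i
skip-< {i₀} {i} i<i₀ with i <? i₀
... | yes _    = ≡.refl
... | no  i≮i₀ = ⊥-elim (i≮i₀ i<i₀)

skip-≥ : ∀ {i₀ i} → i₀ ≤ i → skip i₀ i ≡ suc i
skip-≥ {i₀} {i} i₀≤i with i <? i₀
... | yes i<i₀ = ⊥-elim (<⇒≱ i<i₀ i₀≤i)
... | no  _    = ≡.refl

skip-surjective : ∀ {k i₀ i} → i₀ ≤ k → i < suc k → i ≢ i₀ → ∃ λ i′ → i′ < k × skip i₀ i′ ≡ i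
skip-surjective {k} {i₀} {i} i₀≤k i<1+k i≢i₀ with <-cmp i i₀
... | tri< i<i₀ _ _ = i , <-≤-trans i<i₀ i₀≤k , skip-< i<i₀
... | tri≈ _ i≡i₀ _ = ⊥-elim (i≢i₀ i≡i₀)
skip-surjective {i = suc i′} _ i<1+k _ | tri> _ _ i₀<i = i′ , ≤-pred i<1+k , skip-≥ (≤-pred i₀<i)

module _ {p : ℕ} (pr : Prime p) where

  prime≡suc[p∸1] : p ≡ suc (p ∸ 1)
  prime≡suc[p∸1] = ≡.sym (suc-pred p {{prime⇒nonZero pr}})

  prime∤1 : ¬ p ∣ 1
  prime∤1 p∣1 = nonTrivial⇒≢1 {{prime⇒nonTrivial pr}} (∣1⇒≡1 p∣1)

  prime∤* : ∀ {a b} → ¬ p ∣ a → ¬ p ∣ b → ¬ p ∣ a * b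
  prime∤* {a} {b} p∤a p∤b p∣ab with euclidsLemma a b pr p∣ab
  ... | inj₁ p∣a = p∤a p∣a
  ... | inj₂ p∣b = p∤b p∣b

  prime∤! : ∀ {m} → m < p → ¬ p ∣ m !
  prime∤! {zero}  _   = prime∤1
  prime∤! {suc m} m<p = prime∤* (<⇒≱ m<p ∘ ∣⇒≤) (prime∤! (<-trans (n<1+n m) m<p))

  prime∣C : ∀ {i} → 0 < i → i < p → p ∣ p C i
  prime∣C {i} 0<i i<p =
    [ id , ⊥-elim ∘ prime∤* (prime∤! i<p) (prime∤! (∸-monoʳ-< 0<i (<⇒≤ i<p))) ]′
      (euclidsLemma (p C i) (i ! * (p ∸ i) !) pr p∣C*k![p∸k]!)
    where
    instance
      k![p∸k]!≢0 : NonZero (i ! * (p ∸ i) !)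
      k![p∸k]!≢0 = i !* (p ∸ i) !≢0
    p∣p! : p ∣ p !
    p∣p! = ≡.subst (λ q → q ∣ q !) (≡.sym (prime≡suc[p∸1])) (m∣m*n ((p ∸ 1) !))
    p∣C*k![p∸k]! : p ∣ (p C i) * (i ! * (p ∸ i) !)
    p∣C*k![p∸k]! = ≡.subst (p ∣_) (≡.sym C*k![p∸k]!≡p!) p∣p!
      where
      C*k![p∸k]!≡p! : (p C i) * (i ! * (p ∸ i) !) ≡ p !
      C*k![p∸k]!≡p! = begin
        (p C i) * (i ! * (p ∸ i) !)                   ≡⟨ ≡.cong (_* (i ! * (p ∸ i) !)) (nCk≡n!/k![n-k]! (<⇒≤ i<p)) ⟩
        p ! / (i ! * (p ∸ i) !) * (i ! * (p ∸ i) !) ≡⟨ m/n*n≡m (k![n∸k]!∣n! (<⇒≤ i<p)) ⟩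
        p !                                         ∎
        where open ≡-Reasoning

  prime-Bézout : ∀ {c} → ¬ p ∣ c → Bézout.Identity 1 c p
  prime-Bézout {c} p∤c = coprime-Bézout coprime
    where
    coprime : Coprime c p
    coprime (d∣c , d∣p) with prime⇒irreducible pr d∣p
    ... | inj₁ d≡1 = d≡1
    ... | inj₂ ≡.refl = ⊥-elim (p∤c d∣c)

  NontrivialSolution : ℕ → ℕ → (ℕ → ℕ → ℕ) → Set
  NontrivialSolution k m a =
    ∃ λ (c : ℕ → ℕ) → (∃ λ j → j < m × ¬ p ∣ c j) × (∀ i → i < k → p ∣ Σℕ m (λ j → c j * a j i))

  -- Coefficient of unknown j + 1 in a 0 i₀ · (equation i) − a 0 i · (equation i₀), from which
  -- unknown 0 has been eliminated; p ∸ 1 stands for −1.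
  eliminate : (ℕ → ℕ → ℕ) → ℕ → ℕ → ℕ → ℕ
  eliminate a i₀ j i = a 0 i₀ * a (suc j) i + (p ∸ 1) * (a 0 i * a (suc j) i₀)

  eliminate-pivot : ∀ a i₀ j → eliminate a i₀ j i₀ ≡ p * (a 0 i₀ * a (suc j) i₀)
  eliminate-pivot a i₀ j = ≡.cong (_* (a 0 i₀ * a (suc j) i₀)) (≡.sym prime≡suc[p∸1])

  back-substitute : ℕ → (ℕ → ℕ → ℕ) → ℕ → (ℕ → ℕ) → ℕ → ℕ
  back-substitute m a i₀ d zero    = (p ∸ 1) * Σℕ m (λ j → d j * a (suc j) i₀)
  back-substitute m a i₀ d (suc j) = d j * a 0 i₀

  Σ-back-substitute : ∀ m a i₀ d i → Σℕ (suc m) (λ j → back-substitute m a i₀ d j * a j i)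
                                    ≡ Σℕ m (λ j → d j * eliminate a i₀ j i)
  Σ-back-substitute m a i₀ d i = begin
    (p ∸ 1) * S * a 0 i + Σℕ m (λ j → d j * A₀ * a (suc j) i)
      ≡⟨ +-comm ((p ∸ 1) * S * a 0 i) _ ⟩
    Σℕ m (λ j → d j * A₀ * a (suc j) i) + (p ∸ 1) * S * a 0 i
      ≡⟨ ≡.cong₂ _+_ (Σℕ-cong m (λ j _ → *-assoc (d j) A₀ _))
                     (≡.trans (xyz≡xzy (p ∸ 1) S (a 0 i)) (*-Σℕ m ((p ∸ 1) * a 0 i) _)) ⟩
    Σℕ m (λ j → d j * (A₀ * a (suc j) i)) + Σℕ m (λ j → (p ∸ 1) * a 0 i * (d j * a (suc j) i₀))
      ≡⟨ Σℕ-+ m _ _ ⟨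
    Σℕ m (λ j → d j * (A₀ * a (suc j) i) + (p ∸ 1) * a 0 i * (d j * a (suc j) i₀))
      ≡⟨ Σℕ-cong m (λ j _ → collect (d j) A₀ (a (suc j) i) (p ∸ 1) (a 0 i) (a (suc j) i₀)) ⟩
    Σℕ m (λ j → d j * eliminate a i₀ j i) ∎
    where
    open ≡-Reasoning
    A₀ S : ℕ
    A₀ = a 0 i₀
    S = Σℕ m (λ j → d j * a (suc j) i₀)
    xyz≡xzy : ∀ x y z → x * y * z ≡ x * z * y
    xyz≡xzy = solve-∀
    collect : ∀ d A x q y z → d * (A * x) + q * y * (d * z) ≡ d * (A * x + q * (y * z))
    collect = solve-∀

  back-substitute-solves : ∀ {k m} a {i₀} → i₀ ≤ k → ¬ p ∣ a 0 i₀ →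
                           NontrivialSolution k m (λ j i → eliminate a i₀ j (skip i₀ i)) →
                           NontrivialSolution (suc k) (suc m) a
  back-substitute-solves {k} {m} a {i₀} i₀≤k p∤a₀ (d , (j₀ , j₀<m , p∤dj₀) , d-solves) =
    back-substitute m a i₀ d , (suc j₀ , s<s j₀<m , prime∤* p∤dj₀ p∤a₀) , solves
    where
    solves : ∀ i → i < suc k → p ∣ Σℕ (suc m) (λ j → back-substitute m a i₀ d j * a j i)
    solves i i<1+k with i ≟ i₀
    ... | yes ≡.refl = ≡.subst (p ∣_) (≡.sym (begin
          Σℕ (suc m) (λ j → back-substitute m a i₀ d j * a j i₀) ≡⟨ Σ-back-substitute m a i₀ d i₀ ⟩
          Σℕ m (λ j → d j * eliminate a i₀ j i₀)                 ≡⟨ Σℕ-cong m (λ j _ → ≡.cong (d j *_) (eliminate-pivot a i₀ j)) ⟩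
          Σℕ m (λ j → d j * (p * (a 0 i₀ * a (suc j) i₀)))      ≡⟨ Σℕ-cong m (λ j _ → xyz≡yxz (d j) p _) ⟩
          Σℕ m (λ j → p * (d j * (a 0 i₀ * a (suc j) i₀)))      ≡⟨ *-Σℕ m p _ ⟨
          p * Σℕ m (λ j → d j * (a 0 i₀ * a (suc j) i₀))        ∎))
          (m∣m*n _)
      where
      open ≡-Reasoning
      xyz≡yxz : ∀ x y z → x * (y * z) ≡ y * (x * z)
      xyz≡yxz = solve-∀
    ... | no i≢i₀ with skip-surjective i₀≤k i<1+k i≢i₀
    ...   | i′ , i′<k , ≡.refl = ≡.subst (p ∣_) (≡.sym (Σ-back-substitute m a i₀ d (skip i₀ i′))) (d-solves i′ i′<k)

  unit-solution : ∀ {k m} a → (∀ i → i < k → p ∣ a 0 i) → NontrivialSolution k (suc m) a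
  unit-solution {m = m} a p∣a₀ = e₀ , (0 , z<s , prime∤1) , λ i i<k → ≡.subst (p ∣_) (≡.sym (Σe₀ i)) (p∣a₀ i i<k)
    where
    e₀ : ℕ → ℕ
    e₀ zero    = 1
    e₀ (suc _) = 0
    Σe₀ : ∀ i → Σℕ (suc m) (λ j → e₀ j * a j i) ≡ a 0 i
    Σe₀ i = ≡.trans (≡.cong₂ _+_ (*-identityˡ (a 0 i)) (Σℕ-zero m)) (+-identityʳ (a 0 i))

  underdetermined⇒nontrivialSolution : ∀ {k m} → k < m → ∀ a → NontrivialSolution k m a
  underdetermined⇒nontrivialSolution {zero}  {suc m} _          a = unit-solution a λ _ ()
  underdetermined⇒nontrivialSolution {suc k} {suc m} (s<s k<m) a with ∀<⊎∃¬ (λ i → p ∣? a 0 i) (suc k)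
  ... | inj₁ p∣a₀                     = unit-solution a p∣a₀
  ... | inj₂ (i₀ , s≤s i₀≤k , p∤a₀) = back-substitute-solves a i₀≤k p∤a₀
          (underdetermined⇒nontrivialSolution k<m (λ j i → eliminate a i₀ j (skip i₀ i)))

iter-+ : ∀ {A : Set} a b (f : A → A) x → iter (a + b) f x ≡ iter a f (iter b f x)
iter-+ zero    b f x = ≡.refl
iter-+ (suc a) b f x = ≡.cong f (iter-+ a b f x)

iter-* : ∀ {A : Set} a b (f : A → A) x → iter (a * b) f x ≡ iter a (iter b f) x
iter-* zero    b f x = ≡.refl
iter-* (suc a) b f x = ≡.trans (iter-+ b (a * b) f x) (≡.cong (iter b f) (iter-* a b f x))

module AbelianGroupSums {ℓ : Level} (G : AbelianGroup 0ℓ ℓ) where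
  open AbelianGroup G
  open import Algebra.Properties.CommutativeMonoid.Mult commutativeMonoid public
    renaming (_×_ to _⊗_)
  open import Algebra.Properties.CommutativeSemigroup commutativeSemigroup using (interchange)
  open import Algebra.Properties.AbelianGroup G using (⁻¹-∙-comm)
  open import Algebra.Properties.Group group using (∙-cancelʳ)
  open import Algebra.Definitions.RawMonoid rawMonoid using (sum)
  open import Algebra.Properties.Monoid.Sum monoid public using (sum-cong-≋; sum-replicate-zero)
  open import Relation.Binary.Reasoning.Setoid setoid

  ⊗-ε : ∀ k → k ⊗ ε ≈ ε
  ⊗-ε zero    = refl
  ⊗-ε (suc k) = trans (identityˡ _) (⊗-ε k)

  record Additive (f : Carrier → Carrier) : Set ℓ where
    field
      cong : ∀ {x y} → x ≈ y → f x ≈ f y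
      homo : ∀ x y → f (x ∙ y) ≈ f x ∙ f y

    ε-homo : f ε ≈ ε
    ε-homo = ∙-cancelʳ (f ε) (f ε) ε (trans (sym (homo ε ε)) (trans (cong (identityʳ ε)) (sym (identityˡ (f ε)))))

    ⊗-homo : ∀ k x → f (k ⊗ x) ≈ k ⊗ f x
    ⊗-homo zero    x = ε-homo
    ⊗-homo (suc k) x = trans (homo x (k ⊗ x)) (∙-congˡ (⊗-homo k x))

  iter-additive : ∀ {f} → Additive f → ∀ k → Additive (iter k f)
  iter-additive f-add zero    = record { cong = λ x≈y → x≈y ; homo = λ _ _ → refl }
  iter-additive {f} f-add (suc k) = record
    { cong = Additive.cong f-add ∘ Additive.cong fᵏ-add
    ; homo = λ x y → trans (Additive.cong f-add (Additive.homo fᵏ-add x y)) (Additive.homo f-add _ _) }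
    where
    fᵏ-add : Additive (iter k f)
    fᵏ-add = iter-additive f-add k

  iter-cong : ∀ {g h} → (∀ x → g x ≈ h x) → (∀ {x y} → x ≈ y → h x ≈ h y) →
              ∀ k y → iter k g y ≈ iter k h y
  iter-cong g≈h h-cong zero    y = refl
  iter-cong g≈h h-cong (suc k) y = trans (g≈h _) (h-cong (iter-cong g≈h h-cong k y))

  [_-1] : (Carrier → Carrier) → Carrier → Carrier
  [ τ -1] y = τ y ∙ y ⁻¹

  [-1]-additive : ∀ {τ} → Additive τ → Additive [ τ -1]
  [-1]-additive {τ} τ-add = record
    { cong = λ x≈y → ∙-cong (Additive.cong τ-add x≈y) (⁻¹-cong x≈y)
    ; homo = λ x y → begin
        τ (x ∙ y) ∙ (x ∙ y) ⁻¹      ≈⟨ ∙-cong (Additive.homo τ-add x y) (sym (⁻¹-∙-comm x y)) ⟩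
        (τ x ∙ τ y) ∙ (x ⁻¹ ∙ y ⁻¹) ≈⟨ interchange _ _ _ _ ⟩
        (τ x ∙ x ⁻¹) ∙ (τ y ∙ y ⁻¹) ∎ }

  [-1]-split : ∀ τ y → τ y ≈ [ τ -1] y ∙ y
  [-1]-split τ y = sym (trans (assoc _ _ _) (trans (∙-congˡ (inverseˡ y)) (identityʳ _)))

  ∑ : ℕ → (ℕ → Carrier) → Carrier
  ∑ zero    f = ε
  ∑ (suc k) f = f 0 ∙ ∑ k (f ∘ suc)

  ∑-cong : ∀ k {f g} → (∀ i → i < k → f i ≈ g i) → ∑ k f ≈ ∑ k g
  ∑-cong zero    f≈g = refl
  ∑-cong (suc k) f≈g = ∙-cong (f≈g 0 z<s) (∑-cong k (λ i i<k → f≈g (suc i) (s<s i<k)))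

  ∑-ε : ∀ k {f} → (∀ i → i < k → f i ≈ ε) → ∑ k f ≈ ε
  ∑-ε zero    f≈ε = refl
  ∑-ε (suc k) f≈ε = trans (∙-cong (f≈ε 0 z<s) (∑-ε k (λ i i<k → f≈ε (suc i) (s<s i<k)))) (identityʳ ε)

  ∑-∙ : ∀ k f g → ∑ k (λ i → f i ∙ g i) ≈ ∑ k f ∙ ∑ k g
  ∑-∙ zero    f g = sym (identityʳ ε)
  ∑-∙ (suc k) f g = trans (∙-congˡ (∑-∙ k _ _)) (interchange _ _ _ _)

  ∑-last : ∀ k f → ∑ (suc k) f ≈ ∑ k f ∙ f k
  ∑-last zero    f = trans (identityʳ _) (sym (identityˡ _))
  ∑-last (suc k) f = trans (∙-congˡ (∑-last k (f ∘ suc))) (sym (assoc _ _ _))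

  ∑-shift : ∀ k f → ∑ k (f ∘ suc) ∙ f 0 ≈ ∑ k f ∙ f k
  ∑-shift k f = trans (comm _ _) (∑-last k f)

  ∑-comm : ∀ k l (F : ℕ → ℕ → Carrier) → ∑ k (λ i → ∑ l (F i)) ≈ ∑ l (λ j → ∑ k (λ i → F i j))
  ∑-comm zero    l F = sym (∑-ε l (λ _ _ → refl))
  ∑-comm (suc k) l F = trans (∙-congˡ (∑-comm k l (F ∘ suc))) (sym (∑-∙ l _ _))

  ∑-single : ∀ k f j → j < k → (∀ i → i < k → i ≢ j → f i ≈ ε) → ∑ k f ≈ f j
  ∑-single (suc k) f zero    j<k f≈ε =
    trans (∙-congˡ (∑-ε k (λ i i<k → f≈ε (suc i) (s<s i<k) (λ ())))) (identityʳ _)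
  ∑-single (suc k) f (suc j) (s<s j<k) f≈ε =
    trans (∙-congʳ (f≈ε 0 z<s (λ ()))) (trans (identityˡ _)
      (∑-single k (f ∘ suc) j j<k (λ i i<k i≢j → f≈ε (suc i) (s<s i<k) (i≢j ∘ suc-injective))))

  ⊗-∑ : ∀ c k f → c ⊗ ∑ k f ≈ ∑ k (λ i → c ⊗ f i)
  ⊗-∑ c zero    f = ⊗-ε c
  ⊗-∑ c (suc k) f = trans (×-distrib-+ _ _ c) (∙-congˡ (⊗-∑ c k _))

  Σℕ-⊗ : ∀ k c x → Σℕ k c ⊗ x ≈ ∑ k (λ i → c i ⊗ x)
  Σℕ-⊗ zero    c x = refl
  Σℕ-⊗ (suc k) c x = trans (×-homo-+ x (c 0) _) (∙-congˡ (Σℕ-⊗ k (c ∘ suc) x))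

  Additive-∑ : ∀ {f} → Additive f → ∀ k g → f (∑ k g) ≈ ∑ k (f ∘ g)
  Additive-∑ f-add zero    g = Additive.ε-homo f-add
  Additive-∑ f-add (suc k) g = trans (Additive.homo f-add _ _) (∙-congˡ (Additive-∑ f-add k _))

  sum≈∑ : ∀ k (f : ℕ → Carrier) → sum {k} (f ∘ toℕ) ≈ ∑ k f
  sum≈∑ zero    f = refl
  sum≈∑ (suc k) f = ∙-congˡ (sum≈∑ k (f ∘ suc))

  Additive-sum : ∀ {f} → Additive f → ∀ k (g : Fin k → Carrier) → f (sum g) ≈ sum (f ∘ g)
  Additive-sum f-add zero    g = Additive.ε-homo f-add
  Additive-sum f-add (suc k) g = trans (Additive.homo f-add _ _) (∙-congˡ (Additive-sum f-add k _))

  sum-ε : ∀ k {f : Fin k → Carrier} → (∀ i → f i ≈ ε) → sum f ≈ ε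
  sum-ε k f≈ε = trans (sum-cong-≋ f≈ε) (sum-replicate-zero k)

  sum≈∑-pointwise : ∀ k (F : Fin k → Carrier) (f : ℕ → Carrier) → (∀ i → F i ≈ f (toℕ i)) → sum F ≈ ∑ k f
  sum≈∑-pointwise k F f F≈f = trans (sum-cong-≋ F≈f) (sum≈∑ k f)

  record InSpan (k : ℕ) (v : ℕ → Carrier) (x : Carrier) : Set ℓ where
    constructor span
    field
      coeff   : ℕ → ℕ
      ≈∑ : x ≈ ∑ k (λ i → coeff i ⊗ v i)

  module _ {k : ℕ} {v : ℕ → Carrier} where

    InSpan-resp : ∀ {x y} → x ≈ y → InSpan k v x → InSpan k v y
    InSpan-resp x≈y (span g x≈) = span g (trans (sym x≈y) x≈)

    InSpan-ε : InSpan k v ε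
    InSpan-ε = span (λ _ → 0) (sym (∑-ε k (λ _ _ → refl)))

    InSpan-∙ : ∀ {x y} → InSpan k v x → InSpan k v y → InSpan k v (x ∙ y)
    InSpan-∙ (span g x≈) (span h y≈) = span (λ i → g i + h i)
      (trans (∙-cong x≈ y≈) (trans (sym (∑-∙ k _ _)) (∑-cong k (λ i _ → sym (×-homo-+ (v i) (g i) (h i))))))

    InSpan-⊗ : ∀ {x} a → InSpan k v x → InSpan k v (a ⊗ x)
    InSpan-⊗ a (span g x≈) = span (λ i → a * g i)
      (trans (×-congʳ a x≈) (trans (⊗-∑ a k _) (∑-cong k (λ i _ → ×-assocˡ (v i) a (g i)))))

    InSpan-∑ : ∀ K f → (∀ i → InSpan k v (f i)) → InSpan k v (∑ K f)
    InSpan-∑ zero    f f∈ = InSpan-ε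
    InSpan-∑ (suc K) f f∈ = InSpan-∙ (f∈ 0) (InSpan-∑ K (f ∘ suc) (f∈ ∘ suc))

  InSpan-head : ∀ k v → InSpan (suc k) v (v 0)
  InSpan-head k v = span head (sym (trans (∙-cong (×-homo-1 (v 0)) (∑-ε k (λ _ _ → refl))) (identityʳ _)))
    where
    head : ℕ → ℕ
    head zero    = 1
    head (suc _) = 0

module FpGModuleTheory {p n : ℕ} (M : FpGModule p n) where
  open FpGModule M
  open ModuleNotions M
  open AbelianGroupSums abGroup public hiding (_⊗_)
  open import Algebra.Properties.CommutativeSemigroup commutativeSemigroup using (x∙yz≈y∙xz)
  open import Algebra.Properties.AbelianGroup abGroup using (xyx⁻¹≈y)
  open import Algebra.Properties.Group group using (∙-cancelʳ; inverseʳ-unique)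
  open import Relation.Binary.Reasoning.Setoid setoid

  σ-additive : Additive σ
  σ-additive = record { cong = σ-cong ; homo = σ-hom }

  p∣⇒⊗≈ε : ∀ {a} x → p ∣ a → a ⊗ x ≈ ε
  p∣⇒⊗≈ε x (divides q a≡q*p) =
    trans (×-congˡ a≡q*p) (trans (sym (×-assocˡ x q p)) (trans (×-congʳ q (char-p x)) (⊗-ε q)))

  Independent : ℕ → (ℕ → Carrier) → Set
  Independent m u = ∀ (c : ℕ → ℕ) → ∑ m (λ j → c j ⊗ u j) ≈ ε → ∀ j → j < m → p ∣ c j

  σ^-*N : ∀ i a → σ^ (i * p ^ n) a ≈ a
  σ^-*N zero    a = refl
  σ^-*N (suc i) a = trans (reflexive (iter-+ (p ^ n) (i * p ^ n) σ a))
    (trans (Additive.cong (iter-additive σ-additive (p ^ n)) (σ^-*N i a)) (σ-order a))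

  σ^-periodic : ∀ k i a → σ^ (k + i * p ^ n) a ≈ σ^ k a
  σ^-periodic k i a = trans (reflexive (iter-+ k (i * p ^ n) σ a)) (Additive.cong (iter-additive σ-additive k) (σ^-*N i a))

  module _ (pr : Prime p) where

    instance
      p-nonZero : NonZero p
      p-nonZero = prime⇒nonZero pr

    ⊗≈ε⇒≈ε : ∀ {c z} → ¬ p ∣ c → c ⊗ z ≈ ε → z ≈ ε
    ⊗≈ε⇒≈ε {c} {z} p∤c cz≈ε with prime-Bézout pr p∤c
    ... | Bézout.+- x y 1+yp≡xc = begin
      z                 ≈⟨ sym (identityʳ z) ⟩
      z ∙ ε             ≈⟨ ∙-congˡ (p∣⇒⊗≈ε z (divides y ≡.refl)) ⟨
      (1 + y * p) ⊗ z   ≈⟨ ×-congˡ 1+yp≡xc ⟩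
      (x * c) ⊗ z       ≈⟨ ×-assocˡ z x c ⟨
      x ⊗ (c ⊗ z)       ≈⟨ ×-congʳ x cz≈ε ⟩
      x ⊗ ε             ≈⟨ ⊗-ε x ⟩
      ε                 ∎
    ... | Bézout.-+ x y 1+xc≡yp = begin
      z                 ≈⟨ sym (identityʳ z) ⟩
      z ∙ ε             ≈⟨ ∙-congˡ (trans (×-congʳ x cz≈ε) (⊗-ε x)) ⟨
      z ∙ x ⊗ (c ⊗ z)   ≈⟨ ∙-congˡ (×-assocˡ z x c) ⟩
      (1 + x * c) ⊗ z   ≈⟨ ×-congˡ 1+xc≡yp ⟩
      (y * p) ⊗ z       ≈⟨ p∣⇒⊗≈ε z (divides y ≡.refl) ⟩
      ε                 ∎

    ⊗≈%⊗ : ∀ a y → a ⊗ y ≈ (a % p) ⊗ y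
    ⊗≈%⊗ a y = trans (×-congˡ (m≡m%n+[m/n]*n a p))
      (trans (×-homo-+ y (a % p) _) (trans (∙-congˡ (p∣⇒⊗≈ε y (divides (a / p) ≡.refl))) (identityʳ _)))

    independent⇒≤spanning : ∀ {m k u v} → Independent m u → (∀ j → InSpan k v (u j)) → m ≤ k
    independent⇒≤spanning {m} {k} {u} {v} u-indep u∈span with m ≤? k
    ... | yes m≤k = m≤k
    ... | no  m≰k with underdetermined⇒nontrivialSolution pr (≰⇒> m≰k) (InSpan.coeff ∘ u∈span)
    ...   | c , (j , j<m , p∤cj) , c-solves = ⊥-elim (p∤cj (u-indep c combination≈ε j j<m))
      where
      g : ℕ → ℕ → ℕ
      g = InSpan.coeff ∘ u∈span
      combination≈ε : ∑ m (λ j → c j ⊗ u j) ≈ ε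
      combination≈ε = begin
        ∑ m (λ j → c j ⊗ u j)
          ≈⟨ ∑-cong m (λ j _ → trans (×-congʳ (c j) (InSpan.≈∑ (u∈span j))) (⊗-∑ (c j) k _)) ⟩
        ∑ m (λ j → ∑ k (λ i → c j ⊗ (g j i ⊗ v i)))
          ≈⟨ ∑-cong m (λ j _ → ∑-cong k (λ i _ → ×-assocˡ (v i) (c j) (g j i))) ⟩
        ∑ m (λ j → ∑ k (λ i → (c j * g j i) ⊗ v i))
          ≈⟨ ∑-comm m k _ ⟩
        ∑ k (λ i → ∑ m (λ j → (c j * g j i) ⊗ v i))
          ≈⟨ ∑-cong k (λ i _ → Σℕ-⊗ m (λ j → c j * g j i) (v i)) ⟨
        ∑ k (λ i → Σℕ m (λ j → c j * g j i) ⊗ v i)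
          ≈⟨ ∑-ε k (λ i i<k → p∣⇒⊗≈ε (v i) (c-solves i i<k)) ⟩
        ε ∎

    module _ {τ : Carrier → Carrier} (τ-add : Additive τ) where

      private
        D : Carrier → Carrier
        D = [ τ -1]

      binomial : ∀ j y → iter j τ y ≈ ∑ (suc j) (λ i → (j C i) ⊗ iter i D y)
      binomial zero    y = sym (trans (identityʳ _) (×-homo-1 y))
      binomial (suc j) y = begin
        τ (iter j τ y)
          ≈⟨ Additive.cong τ-add (binomial j y) ⟩
        τ (∑ (suc j) term)
          ≈⟨ Additive-∑ τ-add (suc j) term ⟩
        ∑ (suc j) (τ ∘ term)
          ≈⟨ ∑-cong (suc j) {g = λ i → raised i ∙ term i} (λ i _ → τ-term i) ⟩
        ∑ (suc j) (λ i → raised i ∙ term i)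
          ≈⟨ ∑-∙ (suc j) raised term ⟩
        ∑ (suc j) raised ∙ (1 ⊗ y ∙ ∑ j shifted)
          ≈⟨ ∙-congˡ (∙-congˡ drop-vanishing-term) ⟩
        ∑ (suc j) raised ∙ (1 ⊗ y ∙ ∑ (suc j) shifted)
          ≈⟨ x∙yz≈y∙xz _ _ _ ⟩
        1 ⊗ y ∙ (∑ (suc j) raised ∙ ∑ (suc j) shifted)
          ≈⟨ ∙-congˡ (∑-∙ (suc j) raised shifted) ⟨
        1 ⊗ y ∙ ∑ (suc j) (λ i → raised i ∙ shifted i)
          ≈⟨ ∙-congˡ (∑-cong (suc j) {g = λ i → (suc j C suc i) ⊗ iter (suc i) D y} (λ i _ → pascal i)) ⟩
        ∑ (suc (suc j)) (λ i → (suc j C i) ⊗ iter i D y) ∎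
        where
        term raised shifted : ℕ → Carrier
        term    i = (j C i) ⊗ iter i D y
        raised  i = (j C i) ⊗ iter (suc i) D y
        shifted i = (j C suc i) ⊗ iter (suc i) D y
        τ-term : ∀ i → τ (term i) ≈ raised i ∙ term i
        τ-term i = trans (Additive.⊗-homo τ-add (j C i) _)
                   (trans (×-congʳ (j C i) ([-1]-split τ _)) (×-distrib-+ _ _ (j C i)))
        drop-vanishing-term : ∑ j shifted ≈ ∑ (suc j) shifted
        drop-vanishing-term = sym (trans (∑-last j shifted)
          (trans (∙-congˡ (×-congˡ (k>n⇒nCk≡0 (n<1+n j)))) (identityʳ _)))
        pascal : ∀ i → raised i ∙ shifted i ≈ (suc j C suc i) ⊗ iter (suc i) D y
        pascal i = trans (sym (×-homo-+ _ (j C i) (j C suc i))) (×-congˡ (nCk+nC[k+1]≡[n+1]C[k+1] j i))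

      frobenius : ∀ y → iter p D y ≈ [ iter p τ -1] y
      frobenius y = sym (begin
        iter p τ y ∙ y ⁻¹
          ≈⟨ ∙-congʳ (binomial p y) ⟩
        (1 ⊗ y ∙ ∑ p (λ i → (p C suc i) ⊗ iter (suc i) D y)) ∙ y ⁻¹
          ≈⟨ ∙-congʳ (∙-cong (×-homo-1 y) (∑-single p _ (p ∸ 1) p∸1<p middle-terms-vanish)) ⟩
        (y ∙ (p C suc (p ∸ 1)) ⊗ iter (suc (p ∸ 1)) D y) ∙ y ⁻¹
          ≈⟨ ∙-congʳ (∙-congˡ (reflexive (≡.cong (λ q → (p C q) ⊗ iter q D y) (≡.sym p≡suc[p∸1])))) ⟩
        (y ∙ (p C p) ⊗ iter p D y) ∙ y ⁻¹
          ≈⟨ ∙-congʳ (∙-congˡ (trans (×-congˡ (nCn≡1 p)) (×-homo-1 _))) ⟩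
        (y ∙ iter p D y) ∙ y ⁻¹
          ≈⟨ xyx⁻¹≈y y _ ⟩
        iter p D y ∎)
        where
        p≡suc[p∸1] : p ≡ suc (p ∸ 1)
        p≡suc[p∸1] = prime≡suc[p∸1] pr
        p∸1<p : p ∸ 1 < p
        p∸1<p = ≡.subst (p ∸ 1 <_) (≡.sym p≡suc[p∸1]) (n<1+n (p ∸ 1))
        middle-terms-vanish : ∀ i → i < p → i ≢ p ∸ 1 → (p C suc i) ⊗ iter (suc i) D y ≈ ε
        middle-terms-vanish i i<p i≢p∸1 = p∣⇒⊗≈ε _ (prime∣C pr z<s 1+i<p)
          where
          1+i<p : suc i < p
          1+i<p = ≤∧≢⇒< i<p (λ 1+i≡p → i≢p∸1 (suc-injective (≡.trans 1+i≡p p≡suc[p∸1])))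

    δ^p^k≈[σ^p^k-1] : ∀ k y → δ^ (p ^ k) y ≈ [ σ^ (p ^ k) -1] y
    δ^p^k≈[σ^p^k-1] zero    y = refl
    δ^p^k≈[σ^p^k-1] (suc k) y = begin
      iter (p * p ^ k) δ y     ≈⟨ reflexive (iter-* p (p ^ k) δ y) ⟩
      iter p (δ^ (p ^ k)) y    ≈⟨ iter-cong (δ^p^k≈[σ^p^k-1] k) (Additive.cong ([-1]-additive τ-add)) p y ⟩
      iter p [ τ -1] y         ≈⟨ frobenius τ-add y ⟩
      iter p τ y ∙ y ⁻¹        ≈⟨ ∙-congʳ (reflexive (iter-* p (p ^ k) σ y)) ⟨
      iter (p * p ^ k) σ y ∙ y ⁻¹ ∎
      where
      τ : Carrier → Carrier
      τ = σ^ (p ^ k)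
      τ-add : Additive τ
      τ-add = iter-additive σ-additive (p ^ k)

    δ-nilpotent : ∀ y → δ^ (p ^ n) y ≈ ε
    δ-nilpotent y = trans (δ^p^k≈[σ^p^k-1] n y) (trans (∙-congʳ (σ-order y)) (inverseʳ y))

    [p∸1]⊗≈⁻¹ : ∀ x → (p ∸ 1) ⊗ x ≈ x ⁻¹
    [p∸1]⊗≈⁻¹ x = inverseʳ-unique x _
      (trans (reflexive (≡.cong (_⊗ x) (≡.sym (prime≡suc[p∸1] pr)))) (char-p x))

    orbit : Carrier → ℕ → Carrier
    orbit α k = σ^ k α

    InSpan-orbit : ∀ {K} → 0 < K → ∀ α → InSpan K (orbit α) α
    InSpan-orbit {suc K′} _ α = InSpan-head K′ (orbit α)

    InSpan-orbit-σ : ∀ {K α} → 0 < K → iter K σ α ≈ α → ∀ {x} → InSpan K (orbit α) x → InSpan K (orbit α) (σ x)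
    InSpan-orbit-σ {suc K′} {α} _ σᴷα≈α {x} (span g x≈) = span rotated (begin
      σ x                                     ≈⟨ σ-cong x≈ ⟩
      σ (∑ (suc K′) (λ k → g k ⊗ σ^ k α))     ≈⟨ Additive-∑ σ-additive (suc K′) (λ k → g k ⊗ σ^ k α) ⟩
      ∑ (suc K′) (λ k → σ (g k ⊗ σ^ k α))     ≈⟨ ∑-cong (suc K′) {g = F ∘ suc} (λ k _ → Additive.⊗-homo σ-additive (g k) _) ⟩
      ∑ (suc K′) (F ∘ suc)                    ≈⟨ ∙-cancelʳ (F 0) _ _ wrap-around ⟩
      ∑ (suc K′) F                            ∎)
        where
      rotated : ℕ → ℕ
      rotated zero    = g K′
      rotated (suc k) = g k
      F : ℕ → Carrier
      F k = rotated k ⊗ σ^ k α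
      wrap-around : ∑ (suc K′) (F ∘ suc) ∙ F 0 ≈ ∑ (suc K′) F ∙ F 0
      wrap-around = trans (∑-shift (suc K′) F) (∙-congˡ (×-congʳ (g K′) σᴷα≈α))

    0<N : 0 < p ^ n
    0<N = m^n>0 p n

    InCyclic⇒InSpan : ∀ {α x} → InCyclic α x → InSpan (p ^ n) (orbit α) x
    InCyclic⇒InSpan {α} (f , x≈) =
      span (extend 0 f) $ trans x≈ (sum≈∑-pointwise (p ^ n) _ _ (λ k → ×-congˡ (≡.sym (extend-toℕ 0 f k))))

    InSpan⇒InCyclic : ∀ {α x} → InSpan (p ^ n) (orbit α) x → InCyclic α x
    InSpan⇒InCyclic {α} (span g x≈) = g ∘ toℕ , trans x≈ (sym (sum≈∑ (p ^ n) _))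

    InCyclic-ε : ∀ {α} → InCyclic α ε
    InCyclic-ε = InSpan⇒InCyclic InSpan-ε

    InCyclic-σ : ∀ {α x} → InCyclic α x → InCyclic α (σ x)
    InCyclic-σ {α} = InSpan⇒InCyclic ∘ InSpan-orbit-σ 0<N (σ-order α) ∘ InCyclic⇒InSpan

    InCyclic-δ : ∀ {α x} → InCyclic α x → InCyclic α (δ x)
    InCyclic-δ {α} {x} x∈ = InSpan⇒InCyclic (InSpan-∙ (InCyclic⇒InSpan (InCyclic-σ x∈))
      (InSpan-resp ([p∸1]⊗≈⁻¹ x) (InSpan-⊗ (p ∸ 1) (InCyclic⇒InSpan x∈))))

    InCyclic-δ^ : ∀ α j → InCyclic α (δ^ j α)
    InCyclic-δ^ α zero    = InSpan⇒InCyclic (InSpan-orbit 0<N α)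
    InCyclic-δ^ α (suc j) = InCyclic-δ (InCyclic-δ^ α j)

    module CyclicBasis {α : Carrier} {ℓ : ℕ} (dim : HasDim (InCyclic α) ℓ) where
      private
        v : Fin ℓ → Carrier
        v = proj₁ dim
        v∈ : ∀ j → InCyclic α (v j)
        v∈ = proj₁ (proj₂ dim)
        v-spans : ∀ x → InCyclic α x → ∃ λ c → x ≈ linComb v c
        v-spans = proj₁ (proj₂ (proj₂ dim))
        v-indep : ∀ c → linComb v c ≈ ε → ∀ j → p ∣ c j
        v-indep = proj₂ (proj₂ (proj₂ dim))

      δ-additive : Additive δ
      δ-additive = [-1]-additive σ-additive

      w : ℕ → Carrier
      w j = δ^ j α

      vℕ : ℕ → Carrier
      vℕ = extend ε v

      linComb≈∑ : ∀ c → linComb v c ≈ ∑ ℓ (λ i → extend 0 c i ⊗ vℕ i)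
      linComb≈∑ c = sum≈∑-pointwise ℓ _ _
        (λ i → reflexive (≡.cong₂ _⊗_ (≡.sym (extend-toℕ 0 c i)) (≡.sym (extend-toℕ ε v i))))

      vℕ-independent : Independent ℓ vℕ
      vℕ-independent c ∑≈ε j j<ℓ = ≡.subst (λ i → p ∣ c i) (toℕ-fromℕ< j<ℓ)
        (v-indep (c ∘ toℕ) (trans (sum≈∑-pointwise ℓ _ _ vℕ-toℕ) ∑≈ε) (fromℕ< j<ℓ))
        where
        vℕ-toℕ : ∀ i → c (toℕ i) ⊗ v i ≈ c (toℕ i) ⊗ vℕ (toℕ i)
        vℕ-toℕ i = ×-congʳ (c (toℕ i)) (reflexive (≡.sym (extend-toℕ ε v i)))

      w∈span-v : ∀ j → InSpan ℓ vℕ (w j)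
      w∈span-v j with v-spans (w j) (InCyclic-δ^ α j)
      ... | c , wj≈ = span (extend 0 c) (trans wj≈ (linComb≈∑ c))

      w≈ε? : ∀ j → Dec (w j ≈ ε)
      w≈ε? j with v-spans (w j) (InCyclic-δ^ α j)
      ... | c , wj≈ with all? (λ i → p ∣? c i)
      ...   | yes p∣c = yes (trans wj≈ (sum-ε ℓ (λ i → p∣⇒⊗≈ε (v i) (p∣c i))))
      ...   | no  p∤c = no λ wj≈ε → p∤c (v-indep c (trans (sym wj≈) wj≈ε))

      private
        nilpotency : ∃ λ m → w m ≈ ε × ∀ j → j < m → ¬ w j ≈ ε
        nilpotency = least w≈ε? {p ^ n} (δ-nilpotent α)

      m : ℕ
      m = proj₁ nilpotency

      w-m≈ε : w m ≈ ε
      w-m≈ε = proj₁ (proj₂ nilpotency)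

      w-<m≉ε : ∀ j → j < m → ¬ w j ≈ ε
      w-<m≉ε = proj₂ (proj₂ nilpotency)

      w-≥m≈ε : ∀ {k} → m ≤ k → w k ≈ ε
      w-≥m≈ε {k} m≤k = begin
        iter k δ α                   ≡⟨ ≡.cong (λ q → iter q δ α) (≡.sym (m∸n+n≡m m≤k)) ⟩
        iter ((k ∸ m) + m) δ α       ≡⟨ iter-+ (k ∸ m) m δ α ⟩
        iter (k ∸ m) δ (w m)         ≈⟨ Additive.cong (iter-additive δ-additive (k ∸ m)) w-m≈ε ⟩
        iter (k ∸ m) δ ε             ≈⟨ Additive.ε-homo (iter-additive δ-additive (k ∸ m)) ⟩
        ε                            ∎

      -- Applying δ^(m ∸ suc j) pushes the terms above j past the nilpotency index, while the terms
      -- below j vanish by induction; only c j ⊗ w (m ∸ 1) survives, and w (m ∸ 1) ≉ ε.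
      w-independent : Independent m w
      w-independent c ∑≈ε = <-rec (λ j → j < m → p ∣ c j) step
        where
        step : ∀ j → (∀ {i} → i < j → i < m → p ∣ c i) → j < m → p ∣ c j
        step j lower j<m with p ∣? c j
        ... | yes p∣cj = p∣cj
        ... | no  p∤cj = ⊥-elim (w-<m≉ε (t + j) t+j<m (⊗≈ε⇒≈ε p∤cj cj⊗w≈ε))
          where
          t : ℕ
          t = m ∸ suc j
          t+1+j≡m : t + suc j ≡ m
          t+1+j≡m = m∸n+n≡m j<m
          t+j<m : t + j < m
          t+j<m = ≡.subst (t + j <_) t+1+j≡m (+-monoʳ-< t (n<1+n j))
          other-terms : ∀ i → i < m → i ≢ j → c i ⊗ w (t + i) ≈ ε
          other-terms i i<m i≢j with <-cmp i j
          ... | tri< i<j _ _ = p∣⇒⊗≈ε _ (lower i<j i<m)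
          ... | tri≈ _ i≡j _ = ⊥-elim (i≢j i≡j)
          ... | tri> _ _ j<i = trans (×-congʳ (c i) (w-≥m≈ε (≡.subst (_≤ t + i) t+1+j≡m (+-monoʳ-≤ t j<i)))) (⊗-ε (c i))
          δᵗ-additive : Additive (iter t δ)
          δᵗ-additive = iter-additive δ-additive t
          cj⊗w≈ε : c j ⊗ w (t + j) ≈ ε
          cj⊗w≈ε = begin
            c j ⊗ w (t + j)               ≈⟨ ∑-single m _ j j<m other-terms ⟨
            ∑ m (λ i → c i ⊗ w (t + i))   ≈⟨ ∑-cong m (λ i _ → ×-congʳ (c i) (reflexive (iter-+ t i δ α))) ⟩
            ∑ m (λ i → c i ⊗ iter t δ (w i)) ≈⟨ ∑-cong m (λ i _ → Additive.⊗-homo δᵗ-additive (c i) (w i)) ⟨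
            ∑ m (λ i → iter t δ (c i ⊗ w i)) ≈⟨ Additive-∑ δᵗ-additive m (λ i → c i ⊗ w i) ⟨
            iter t δ (∑ m (λ i → c i ⊗ w i)) ≈⟨ Additive.cong δᵗ-additive ∑≈ε ⟩
            iter t δ ε                    ≈⟨ Additive.ε-homo δᵗ-additive ⟩
            ε                             ∎

      shift : (ℕ → ℕ) → ℕ → ℕ
      shift g zero    = 0
      shift g (suc j) = g j

      δ-∑ : ∀ g → δ (∑ m (λ j → g j ⊗ w j)) ≈ ∑ m (λ j → shift g j ⊗ w j)
      δ-∑ g = begin
        δ (∑ m (λ j → g j ⊗ w j))   ≈⟨ Additive-∑ δ-additive m (λ j → g j ⊗ w j) ⟩
        ∑ m (λ j → δ (g j ⊗ w j))   ≈⟨ ∑-cong m {g = F ∘ suc} (λ j _ → Additive.⊗-homo δ-additive (g j) (w j)) ⟩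
        ∑ m (F ∘ suc)               ≈⟨ identityʳ _ ⟨
        ∑ m (F ∘ suc) ∙ F 0         ≈⟨ ∑-shift m F ⟩
        ∑ m F ∙ F m                 ≈⟨ ∙-congˡ (trans (×-congʳ (shift g m) w-m≈ε) (⊗-ε (shift g m))) ⟩
        ∑ m F ∙ ε                   ≈⟨ identityʳ _ ⟩
        ∑ m F                       ∎
        where
        F : ℕ → Carrier
        F j = shift g j ⊗ w j

      InSpan-δ : ∀ {x} → InSpan m w x → InSpan m w (δ x)
      InSpan-δ (span g x≈) = span (shift g) (trans (Additive.cong δ-additive x≈) (δ-∑ g))

      InSpan-σ : ∀ {x} → InSpan m w x → InSpan m w (σ x)
      InSpan-σ {x} x∈ = InSpan-resp (sym ([-1]-split σ x)) (InSpan-∙ (InSpan-δ x∈) x∈)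

      α∈span : ∀ k → w k ≈ ε → InSpan k w α
      α∈span zero    α≈ε = InSpan-resp (sym α≈ε) InSpan-ε
      α∈span (suc k) _   = InSpan-head k w

      orbit∈span : ∀ k → InSpan m w (orbit α k)
      orbit∈span zero    = α∈span m w-m≈ε
      orbit∈span (suc k) = InSpan-σ (orbit∈span k)

      cyclic⊆span : ∀ {x} → InCyclic α x → InSpan m w x
      cyclic⊆span x∈ with InCyclic⇒InSpan x∈
      ... | span g x≈ = InSpan-resp (sym x≈) (InSpan-∑ (p ^ n) _ (λ k → InSpan-⊗ (g k) (orbit∈span k)))

      ℓ≡m : ℓ ≡ m
      ℓ≡m = ≤-antisym
        (independent⇒≤spanning vℕ-independent (cyclic⊆span ∘ extend-preserves (InCyclic α) InCyclic-ε v∈))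
        (independent⇒≤spanning w-independent w∈span-v)

      ∑≈top-term : ∀ k (g : ℕ → ℕ) → w k ≈ ε → (∀ j → suc j < k → p ∣ g j) →
                   ∑ k (λ j → g j ⊗ w j) ≈ g (k ∸ 1) ⊗ w (k ∸ 1)
      ∑≈top-term zero    g w-0≈ε _   = sym (trans (×-congʳ (g 0) w-0≈ε) (⊗-ε (g 0)))
      ∑≈top-term (suc k) g _     p∣g = ∑-single (suc k) _ k (n<1+n k) lower-terms
        where
        lower-terms : ∀ i → i < suc k → i ≢ k → g i ⊗ w i ≈ ε
        lower-terms i i<1+k i≢k = p∣⇒⊗≈ε (w i) (p∣g i (s<s (≤∧≢⇒< (≤-pred i<1+k) i≢k)))

      -- δ shifts the coordinates along w, so δ x ≈ ε forces all but the top coordinate to vanish.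
      fixed-point : ∀ {x} → InCyclic α x → σ x ≈ x → ∃ λ (c : Fin p) → x ≈ toℕ c ⊗ δ^ (ℓ ∸ 1) α
      fixed-point {x} x∈ σx≈x with cyclic⊆span x∈
      ... | span g x≈ = fromℕ< (m%n<n a p) , (begin
        x                              ≈⟨ x≈ ⟩
        ∑ m (λ j → g j ⊗ w j)          ≈⟨ ∑≈top-term m g w-m≈ε lower-coeffs ⟩
        a ⊗ w (m ∸ 1)                  ≈⟨ ⊗≈%⊗ a (w (m ∸ 1)) ⟩
        (a % p) ⊗ w (m ∸ 1)            ≡⟨ ≡.cong₂ (λ c k → c ⊗ w (k ∸ 1)) (≡.sym (toℕ-fromℕ< (m%n<n a p))) (≡.sym ℓ≡m) ⟩
        toℕ (fromℕ< (m%n<n a p)) ⊗ w (ℓ ∸ 1) ∎)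
        where
        a : ℕ
        a = g (m ∸ 1)
        δx≈ε : δ x ≈ ε
        δx≈ε = trans (∙-congʳ σx≈x) (inverseʳ x)
        lower-coeffs : ∀ j → suc j < m → p ∣ g j
        lower-coeffs j = w-independent (shift g)
          (trans (sym (δ-∑ g)) (trans (Additive.cong δ-additive (sym x≈)) δx≈ε)) (suc j)

    fixed⇒zVec : ∀ {r α ℓα} → IsCyclicDecomposition r α → (∀ i → HasDim (InCyclic (α i)) (ℓα i)) →
                 ∀ a → σ a ≈ a → ∃ λ (cv : Fin r → Fin p) → a ≈ zVec α ℓα cv
    fixed⇒zVec {r} {α} {ℓα} (decompose , unique) dims a σa≈a with decompose a
    ... | xs , xs∈ , a≈ = proj₁ ∘ component , trans a≈ (sum-cong-≋ (proj₂ ∘ component))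
      where
      σxs∈ : ∀ i → InCyclic (α i) (σ (xs i))
      σxs∈ i = InCyclic-σ (xs∈ i)
      σxs≈xs : ∀ i → σ (xs i) ≈ xs i
      σxs≈xs = unique (σ ∘ xs) xs σxs∈ xs∈
        (trans (sym (Additive-sum σ-additive r xs)) (trans (σ-cong (sym a≈)) (trans σa≈a a≈)))
      component : ∀ i → ∃ λ (c : Fin p) → xs i ≈ toℕ c ⊗ δ^ (ℓα i ∸ 1) (α i)
      component i = CyclicBasis.fixed-point (dims i) (xs∈ i) (σxs≈xs i)

module Congruence (N : ℕ) where

  -- Congruence modulo N, stated without truncated subtraction.
  infix 4 _≈ₘ_
  _≈ₘ_ : ℕ → ℕ → Set
  a ≈ₘ b = ∃₂ λ i j → a + i * N ≡ b + j * N

  ≈ₘ-isEquivalence : IsEquivalence _≈ₘ_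
  ≈ₘ-isEquivalence = record
    { refl  = 0 , 0 , ≡.refl
    ; sym   = λ (i , j , eq) → j , i , ≡.sym eq
    ; trans = λ {a} {b} {c} (i , j , eq₁) (k , l , eq₂) → i + k , l + j , (begin
        a + (i + k) * N        ≡⟨ distrib a i k N ⟩
        (a + i * N) + k * N    ≡⟨ ≡.cong (_+ k * N) eq₁ ⟩
        (b + j * N) + k * N    ≡⟨ swap b j k N ⟩
        (b + k * N) + j * N    ≡⟨ ≡.cong (_+ j * N) eq₂ ⟩
        (c + l * N) + j * N    ≡⟨ distrib c l j N ⟨
        c + (l + j) * N        ∎) }
    where
    open ≡-Reasoning
    distrib : ∀ a i k N → a + (i + k) * N ≡ (a + i * N) + k * N
    distrib = solve-∀
    swap : ∀ b j k N → (b + j * N) + k * N ≡ (b + k * N) + j * N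
    swap = solve-∀

  ≈ₘ-setoid : Setoid _ _
  ≈ₘ-setoid = record { isEquivalence = ≈ₘ-isEquivalence }

  open IsEquivalence ≈ₘ-isEquivalence public
    renaming (refl to ≈ₘ-refl; sym to ≈ₘ-sym; trans to ≈ₘ-trans; reflexive to ≡⇒≈ₘ)

  +-cong-≈ₘ : ∀ {a b c d} → a ≈ₘ b → c ≈ₘ d → a + c ≈ₘ b + d
  +-cong-≈ₘ {a} {b} {c} {d} (i , j , eq₁) (k , l , eq₂) = i + k , j + l ,
    ≡.trans (regroup a c i k N) (≡.trans (≡.cong₂ _+_ eq₁ eq₂) (≡.sym (regroup b d j l N)))
    where
    regroup : ∀ a c i k N → (a + c) + (i + k) * N ≡ (a + i * N) + (c + k * N)
    regroup = solve-∀

  *-congˡ-≈ₘ : ∀ c {a b} → a ≈ₘ b → c * a ≈ₘ c * b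
  *-congˡ-≈ₘ c {a} {b} (i , j , eq) = c * i , c * j ,
    ≡.trans (factor c a i N) (≡.trans (≡.cong (c *_) eq) (≡.sym (factor c b j N)))
    where
    factor : ∀ c a i N → c * a + (c * i) * N ≡ c * (a + i * N)
    factor = solve-∀

  +-cancelˡ-≈ₘ : ∀ a {x y} → a + x ≈ₘ a + y → x ≈ₘ y
  +-cancelˡ-≈ₘ a {x} {y} (i , j , eq) = i , j , +-cancelˡ-≡ a _ _
    (≡.trans (≡.sym (+-assoc a x (i * N))) (≡.trans eq (+-assoc a y (j * N))))

  N≈ₘ0 : N ≈ₘ 0
  N≈ₘ0 = 0 , 1 , ≡.refl

  k*N≈ₘ0 : ∀ k → k * N ≈ₘ 0
  k*N≈ₘ0 k = 0 , k , +-identityʳ (k * N)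

  ≈ₘ∧<⇒≡ : ∀ {a b} .{{_ : NonZero N}} → a < N → b < N → a ≈ₘ b → a ≡ b
  ≈ₘ∧<⇒≡ {a} {b} a<N b<N (i , j , eq) = begin
    a                ≡⟨ m<n⇒m%n≡m a<N ⟨
    a % N            ≡⟨ [m+kn]%n≡m%n a i N ⟨
    (a + i * N) % N  ≡⟨ ≡.cong (_% N) eq ⟩
    (b + j * N) % N  ≡⟨ [m+kn]%n≡m%n b j N ⟩
    b % N            ≡⟨ m<n⇒m%n≡m b<N ⟩
    b                ∎
    where open ≡-Reasoning

  ModEq⇒≈ₘ : ∀ {a b} → ModEq N a b → a ≈ₘ b
  ModEq⇒≈ₘ {a} {b} (divides q a∸b≡qN , divides q′ b∸a≡q′N) with ≤-total a b
  ... | inj₁ a≤b = q′ , 0 , ≡.trans (≡.cong (a +_) (≡.sym b∸a≡q′N)) (≡.trans (m+[n∸m]≡n a≤b) (≡.sym (+-identityʳ b)))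
  ... | inj₂ b≤a = 0 , q , ≡.trans (+-identityʳ a) (≡.trans (≡.sym (m+[n∸m]≡n b≤a)) (≡.cong (b +_) a∸b≡qN))

  ≈ₘ⇒ModEq : ∀ {a b} → a ≈ₘ b → ModEq N a b
  ≈ₘ⇒ModEq {a} {b} (i , j , eq) = N∣∸ a b i j eq , N∣∸ b a j i (≡.sym eq)
    where
    N∣∸ : ∀ a b i j → a + i * N ≡ b + j * N → N ∣ a ∸ b
    N∣∸ a b i j eq = divides (j ∸ i) (begin
      a ∸ b                      ≡⟨ [m+n]∸[m+o]≡n∸o (i * N) a b ⟨
      (i * N + a) ∸ (i * N + b)  ≡⟨ ≡.cong₂ _∸_ (+-comm (i * N) a) (+-comm (i * N) b) ⟩
      (a + i * N) ∸ (b + i * N)  ≡⟨ ≡.cong (_∸ (b + i * N)) eq ⟩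
      (b + j * N) ∸ (b + i * N)  ≡⟨ [m+n]∸[m+o]≡n∸o b (j * N) (i * N) ⟩
      j * N ∸ i * N              ≡⟨ *-distribʳ-∸ N j i ⟨
      (j ∸ i) * N                ∎)
      where open ≡-Reasoning

module NormalForm {p n : ℕ} (M : FpGModule p n) .{{_ : NonZero (p ^ n)}} (z : FpGModule.Carrier M) where
  open FpGModule M using (Carrier; σ; _⁻¹; _⊗_; inverseʳ; identityʳ) renaming (_∙_ to _+ᴬ_; ε to 0ᴬ)
  open ModuleNotions M
  open Group (PresGroup z) using (setoid)
  open import Algebra.Properties.Group (PresGroup z) using (inverseʳ-unique; ⁻¹-anti-homo-∙; ε⁻¹≈ε; ∙-cancelʳ)
  open import Algebra.Properties.Monoid (Group.monoid (PresGroup z)) using (cancelʳ)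
  open import Relation.Binary.Reasoning.Setoid setoid

  infix 4 _∼_
  _∼_ : Word → Word → Set
  x ∼ y = x ∼[ z ] y

  N : ℕ
  N = p ^ n

  gen-ε : gen 0ᴬ ∼ e
  gen-ε = ∙-cancelʳ (gen 0ᴬ) (gen 0ᴬ) e (begin
    gen 0ᴬ · gen 0ᴬ  ≈⟨ gen-hom 0ᴬ 0ᴬ ⟨
    gen (0ᴬ +ᴬ 0ᴬ)   ≈⟨ gen-cong (identityʳ 0ᴬ) ⟩
    gen 0ᴬ           ≈⟨ w-idˡ (gen 0ᴬ) ⟨
    e · gen 0ᴬ       ∎)

  gen-inverse : ∀ a → gen a · gen (a ⁻¹) ∼ e
  gen-inverse a = ∼-trans (∼-sym (gen-hom a (a ⁻¹))) (∼-trans (gen-cong (inverseʳ a)) gen-ε)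

  ŝ·gen : ∀ b → ŝ · gen b ∼ gen (σ b) · ŝ
  ŝ·gen b = begin
    ŝ · gen b                   ≈⟨ cancelʳ (w-invˡ ŝ) (ŝ · gen b) ⟨
    ((ŝ · gen b) · inv ŝ) · ŝ   ≈⟨ w-·-cong (conj-rel b) ∼-refl ⟩
    gen (σ b) · ŝ               ∎

  ŝpow·gen : ∀ k b → ŝpow k · gen b ∼ gen (σ^ k b) · ŝpow k
  ŝpow·gen zero    b = ∼-trans (w-idˡ (gen b)) (∼-sym (w-idʳ (gen b)))
  ŝpow·gen (suc k) b = begin
    (ŝ · ŝpow k) · gen b             ≈⟨ w-assoc ŝ (ŝpow k) (gen b) ⟩
    ŝ · (ŝpow k · gen b)             ≈⟨ w-·-cong ∼-refl (ŝpow·gen k b) ⟩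
    ŝ · (gen (σ^ k b) · ŝpow k)      ≈⟨ w-assoc ŝ _ _ ⟨
    (ŝ · gen (σ^ k b)) · ŝpow k      ≈⟨ w-·-cong (ŝ·gen (σ^ k b)) ∼-refl ⟩
    (gen (σ^ (suc k) b) · ŝ) · ŝpow k ≈⟨ w-assoc _ ŝ (ŝpow k) ⟩
    gen (σ^ (suc k) b) · ŝpow (suc k) ∎

  ŝpow-+ : ∀ k m → ŝpow (k + m) ∼ ŝpow k · ŝpow m
  ŝpow-+ zero    m = ∼-sym (w-idˡ (ŝpow m))
  ŝpow-+ (suc k) m = ∼-trans (w-·-cong ∼-refl (ŝpow-+ k m)) (∼-sym (w-assoc ŝ (ŝpow k) (ŝpow m)))

  ŝpow-*N : ∀ q → ŝpow (q * N) ∼ gen (q ⊗ z)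
  ŝpow-*N zero    = ∼-sym gen-ε
  ŝpow-*N (suc q) = begin
    ŝpow (N + q * N)           ≈⟨ ŝpow-+ N (q * N) ⟩
    ŝpow N · ŝpow (q * N)      ≈⟨ w-·-cong pow-rel (ŝpow-*N q) ⟩
    gen z · gen (q ⊗ z)        ≈⟨ gen-hom z (q ⊗ z) ⟨
    gen (suc q ⊗ z)            ∎

  normal-· : ∀ a k b m → (gen a · ŝpow k) · (gen b · ŝpow m) ∼ gen (a +ᴬ σ^ k b) · ŝpow (k + m)
  normal-· a k b m = begin
    (gen a · ŝpow k) · (gen b · ŝpow m)     ≈⟨ w-assoc (gen a) (ŝpow k) _ ⟩
    gen a · (ŝpow k · (gen b · ŝpow m))     ≈⟨ w-·-cong ∼-refl (w-assoc (ŝpow k) (gen b) (ŝpow m)) ⟨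
    gen a · ((ŝpow k · gen b) · ŝpow m)     ≈⟨ w-·-cong ∼-refl (w-·-cong (ŝpow·gen k b) ∼-refl) ⟩
    gen a · ((gen (σ^ k b) · ŝpow k) · ŝpow m) ≈⟨ w-·-cong ∼-refl (w-assoc _ (ŝpow k) (ŝpow m)) ⟩
    gen a · (gen (σ^ k b) · (ŝpow k · ŝpow m)) ≈⟨ w-·-cong ∼-refl (w-·-cong ∼-refl (ŝpow-+ k m)) ⟨
    gen a · (gen (σ^ k b) · ŝpow (k + m))   ≈⟨ w-assoc (gen a) _ _ ⟨
    (gen a · gen (σ^ k b)) · ŝpow (k + m)   ≈⟨ w-·-cong (gen-hom a (σ^ k b)) ∼-refl ⟨
    gen (a +ᴬ σ^ k b) · ŝpow (k + m)        ∎

  Normal : Word → Set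
  Normal x = ∃₂ λ a k → x ∼ gen a · ŝpow k

  Normal-resp : ∀ {x y} → x ∼ y → Normal x → Normal y
  Normal-resp x∼y (a , k , x∼) = a , k , ∼-trans (∼-sym x∼y) x∼

  Normal-· : ∀ {x y} → Normal x → Normal y → Normal (x · y)
  Normal-· (a , k , x∼) (b , m , y∼) = _ , _ , ∼-trans (w-·-cong x∼ y∼) (normal-· a k b m)

  Normal-gen : ∀ a → Normal (gen a)
  Normal-gen a = a , 0 , ∼-sym (w-idʳ (gen a))

  Normal-e : Normal e
  Normal-e = Normal-resp gen-ε (Normal-gen 0ᴬ)

  Normal-ŝ : Normal ŝ
  Normal-ŝ = 0ᴬ , 1 , ∼-sym (∼-trans (w-·-cong gen-ε (w-idʳ ŝ)) (w-idˡ ŝ))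

  Normal-ŝpow : ∀ k → Normal (ŝpow k)
  Normal-ŝpow zero    = Normal-e
  Normal-ŝpow (suc k) = Normal-· Normal-ŝ (Normal-ŝpow k)

  Normal-inv-gen : ∀ a → Normal (inv (gen a))
  Normal-inv-gen a = Normal-resp (inverseʳ-unique (gen a) (gen (a ⁻¹)) (gen-inverse a)) (Normal-gen (a ⁻¹))

  Normal-inv-ŝ : Normal (inv ŝ)
  Normal-inv-ŝ = Normal-resp (inverseʳ-unique ŝ _ ŝ·ŝ⁻¹∼e) (Normal-· (Normal-ŝpow (N ∸ 1)) (Normal-gen (z ⁻¹)))
    where
    ŝ·ŝ⁻¹∼e : ŝ · (ŝpow (N ∸ 1) · gen (z ⁻¹)) ∼ e
    ŝ·ŝ⁻¹∼e = begin
      ŝ · (ŝpow (N ∸ 1) · gen (z ⁻¹))   ≈⟨ w-assoc ŝ _ _ ⟨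
      ŝpow (suc (N ∸ 1)) · gen (z ⁻¹)   ≡⟨ ≡.cong (λ K → ŝpow K · gen (z ⁻¹)) (suc-pred N) ⟩
      ŝpow N · gen (z ⁻¹)               ≈⟨ w-·-cong pow-rel ∼-refl ⟩
      gen z · gen (z ⁻¹)                ≈⟨ gen-inverse z ⟩
      e                                 ∎

  Normal-inv-ŝpow : ∀ k → Normal (inv (ŝpow k))
  Normal-inv-ŝpow zero    = Normal-resp (∼-sym ε⁻¹≈ε) Normal-e
  Normal-inv-ŝpow (suc k) =
    Normal-resp (∼-sym (⁻¹-anti-homo-∙ ŝ (ŝpow k))) (Normal-· (Normal-inv-ŝpow k) Normal-inv-ŝ)

  Normal-inv : ∀ {x} → Normal x → Normal (inv x)
  Normal-inv (a , k , x∼) = Normal-resp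
    (∼-sym (∼-trans (w-inv-cong x∼) (⁻¹-anti-homo-∙ (gen a) (ŝpow k))))
    (Normal-· (Normal-inv-ŝpow k) (Normal-inv-gen a))

  normal : ∀ x → Normal x
  normal (gen a) = Normal-gen a
  normal ŝ       = Normal-ŝ
  normal e       = Normal-e
  normal (x · y) = Normal-· (normal x) (normal y)
  normal (inv x) = Normal-inv (normal x)

  reduced-normal : ∀ x → ∃₂ λ a k → k < N × x ∼ gen a · ŝpow k
  reduced-normal x with normal x
  ... | a , k , x∼ = a +ᴬ σ^ r (q ⊗ z) , r , m%n<n k N , ∼-trans x∼ reduce
    where
    r q : ℕ
    r = k % N
    q = k / N
    reduce : gen a · ŝpow k ∼ gen (a +ᴬ σ^ r (q ⊗ z)) · ŝpow r
    reduce = begin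
      gen a · ŝpow k                      ≡⟨ ≡.cong (λ K → gen a · ŝpow K) (m≡m%n+[m/n]*n k N) ⟩
      gen a · ŝpow (r + q * N)            ≈⟨ w-·-cong ∼-refl (ŝpow-+ r (q * N)) ⟩
      gen a · (ŝpow r · ŝpow (q * N))     ≈⟨ w-·-cong ∼-refl (w-·-cong ∼-refl (ŝpow-*N q)) ⟩
      gen a · (ŝpow r · gen (q ⊗ z))      ≈⟨ w-·-cong ∼-refl (ŝpow·gen r (q ⊗ z)) ⟩
      gen a · (gen (σ^ r (q ⊗ z)) · ŝpow r) ≈⟨ w-assoc (gen a) _ _ ⟨
      (gen a · gen (σ^ r (q ⊗ z))) · ŝpow r ≈⟨ w-·-cong (gen-hom a _) ∼-refl ⟨
      gen (a +ᴬ σ^ r (q ⊗ z)) · ŝpow r    ∎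

module EmbeddingProblemTheory {p n : ℕ} (M : FpGModule p n) (pr : Prime p)
  {c ℓ : Level} (Ĝ : Group c ℓ) (ι : FpGModule.Carrier M → Group.Carrier Ĝ) (φ : Group.Carrier Ĝ → ℕ)
  (emb : ModuleNotions.IsEmbeddingProblem M Ĝ ι φ) where

  module A = FpGModule M
  open ModuleNotions M
  open IsEmbeddingProblem emb
  open Group Ĝ
  open import Algebra.Properties.Group Ĝ using (∙-cancelʳ)
  open import Algebra.Properties.Monoid monoid using (cancelʳ)
  module Ĝ-Reasoning = SetoidReasoning setoid
  module ι = GroupMorphisms.IsGroupMonomorphism ι-mono

  N : ℕ
  N = p ^ n

  instance
    N-nonZero : NonZero N
    N-nonZero = m^n≢0 p n {{prime⇒nonZero pr}}

  open Congruence N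
  module ≈ₘ-Reasoning = SetoidReasoning ≈ₘ-setoid

  σ^-resp-≈ₘ : ∀ {k k′} → k ≈ₘ k′ → ∀ a → σ^ k a A.≈ σ^ k′ a
  σ^-resp-≈ₘ {k} {k′} (i , j , eq) a = A.trans (A.sym (σ^-periodic k i a))
    (A.trans (A.reflexive (≡.cong (λ q → σ^ q a) eq)) (σ^-periodic k′ j a))
    where open FpGModuleTheory M using (σ^-periodic)

  φ-homo : ∀ x y → φ (x ∙ y) ≈ₘ φ x + φ y
  φ-homo x y = ModEq⇒≈ₘ (φ-hom x y)

  φ-resp : ∀ {x y} → x ≈ y → φ x ≈ₘ φ y
  φ-resp x≈y = ModEq⇒≈ₘ (φ-cong x≈y)

  φ-ε : φ ε ≈ₘ 0
  φ-ε = +-cancelˡ-≈ₘ (φ ε) (begin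
    φ ε + φ ε    ≈⟨ ≈ₘ-sym (φ-homo ε ε) ⟩
    φ (ε ∙ ε)    ≈⟨ φ-resp (identityʳ ε) ⟩
    φ ε          ≡⟨ +-identityʳ (φ ε) ⟨
    φ ε + 0      ∎)
    where open ≈ₘ-Reasoning

  x+[N∸1]x≈ₘ0 : ∀ x → x + (N ∸ 1) * x ≈ₘ 0
  x+[N∸1]x≈ₘ0 x = ≈ₘ-trans (≡⇒≈ₘ (≡.trans (≡.cong (_* x) (suc-pred N)) (*-comm N x))) (k*N≈ₘ0 x)

  φ-⁻¹ : ∀ x → φ (x ⁻¹) ≈ₘ (N ∸ 1) * φ x
  φ-⁻¹ x = +-cancelˡ-≈ₘ (φ x) (begin
    φ x + φ (x ⁻¹)      ≡⟨ +-comm (φ x) _ ⟩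
    φ (x ⁻¹) + φ x      ≈⟨ ≈ₘ-sym (φ-homo (x ⁻¹) x) ⟩
    φ (x ⁻¹ ∙ x)        ≈⟨ φ-resp (inverseˡ x) ⟩
    φ ε                 ≈⟨ φ-ε ⟩
    0                   ≈⟨ ≈ₘ-sym (x+[N∸1]x≈ₘ0 (φ x)) ⟩
    φ x + (N ∸ 1) * φ x ∎)
    where open ≈ₘ-Reasoning

  lift : Carrier
  lift = proj₁ (φ-surj 1)

  φ-lift : φ lift ≈ₘ 1
  φ-lift = ModEq⇒≈ₘ (proj₂ (φ-surj 1))

  ⟦_⟧ : Word → Carrier
  ⟦ gen a ⟧ = ι a
  ⟦ ŝ ⟧     = lift
  ⟦ e ⟧     = ε
  ⟦ x · y ⟧ = ⟦ x ⟧ ∙ ⟦ y ⟧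
  ⟦ inv x ⟧ = ⟦ x ⟧ ⁻¹

  φ-⟦⟧ : ∀ w → φ ⟦ w ⟧ ≈ₘ φPres w
  φ-⟦⟧ (gen a) = ModEq⇒≈ₘ (φ∘ι a)
  φ-⟦⟧ ŝ       = φ-lift
  φ-⟦⟧ e       = φ-ε
  φ-⟦⟧ (x · y) = ≈ₘ-trans (φ-homo ⟦ x ⟧ ⟦ y ⟧) (+-cong-≈ₘ (φ-⟦⟧ x) (φ-⟦⟧ y))
  φ-⟦⟧ (inv x) = ≈ₘ-trans (φ-⁻¹ ⟦ x ⟧) (*-congˡ-≈ₘ (N ∸ 1) (φ-⟦⟧ x))

  φPres-ŝpow : ∀ k → φPres (ŝpow k) ≡ k
  φPres-ŝpow zero    = ≡.refl
  φPres-ŝpow (suc k) = ≡.cong suc (φPres-ŝpow k)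

  lift^ : ℕ → Carrier
  lift^ k = ⟦ ŝpow k ⟧

  φ-lift^ : ∀ k → φ (lift^ k) ≈ₘ k
  φ-lift^ k = ≈ₘ-trans (φ-⟦⟧ (ŝpow k)) (≡⇒≈ₘ (φPres-ŝpow k))

  lift-comm : ∀ k → lift ∙ lift^ k ≈ lift^ k ∙ lift
  lift-comm zero    = trans (identityʳ lift) (sym (identityˡ lift))
  lift-comm (suc k) = trans (∙-congˡ (lift-comm k)) (sym (assoc lift (lift^ k) lift))

  private
    lift^N∈ker : ∃ λ a → ι a ≈ lift^ N
    lift^N∈ker = ker⊆im (lift^ N) (≈ₘ⇒ModEq (≈ₘ-trans (φ-lift^ N) N≈ₘ0))

  a₀ : A.Carrier
  a₀ = proj₁ lift^N∈ker

  ι-a₀ : ι a₀ ≈ lift^ N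
  ι-a₀ = proj₂ lift^N∈ker

  σ-a₀ : A.σ a₀ A.≈ a₀
  σ-a₀ = ι.injective (begin
    ι (σ^ 1 a₀)                       ≈⟨ ι.⟦⟧-cong (σ^-resp-≈ₘ φ-lift a₀) ⟨
    ι (σ^ (φ lift) a₀)                ≈⟨ conj lift a₀ ⟨
    (lift ∙ ι a₀) ∙ lift ⁻¹           ≈⟨ ∙-congʳ (∙-congˡ ι-a₀) ⟩
    (lift ∙ lift^ N) ∙ lift ⁻¹        ≈⟨ ∙-congʳ (lift-comm N) ⟩
    (lift^ N ∙ lift) ∙ lift ⁻¹        ≈⟨ cancelʳ (inverseʳ lift) (lift^ N) ⟩
    lift^ N                           ≈⟨ ι-a₀ ⟨
    ι a₀                              ∎)
    where open Ĝ-Reasoning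

  module Isomorphism (z : A.Carrier) (lift^N≈ιz : lift^ N ≈ ι z) where
    open NormalForm M z using (_∼_; reduced-normal)

    ⟦⟧-resp : ∀ {x y} → x ∼ y → ⟦ x ⟧ ≈ ⟦ y ⟧
    ⟦⟧-resp ∼-refl             = refl
    ⟦⟧-resp (∼-sym x∼y)        = sym (⟦⟧-resp x∼y)
    ⟦⟧-resp (∼-trans x∼y y∼w)  = trans (⟦⟧-resp x∼y) (⟦⟧-resp y∼w)
    ⟦⟧-resp (w-·-cong x∼ y∼)   = ∙-cong (⟦⟧-resp x∼) (⟦⟧-resp y∼)
    ⟦⟧-resp (w-inv-cong x∼y)   = ⁻¹-cong (⟦⟧-resp x∼y)
    ⟦⟧-resp (w-assoc x y w)    = assoc _ _ _
    ⟦⟧-resp (w-idˡ x)          = identityˡ _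
    ⟦⟧-resp (w-idʳ x)          = identityʳ _
    ⟦⟧-resp (w-invˡ x)         = inverseˡ _
    ⟦⟧-resp (w-invʳ x)         = inverseʳ _
    ⟦⟧-resp (gen-cong a≈b)     = ι.⟦⟧-cong a≈b
    ⟦⟧-resp (gen-hom a b)      = ι.∙-homo a b
    ⟦⟧-resp (conj-rel a)       = trans (conj lift a) (ι.⟦⟧-cong (σ^-resp-≈ₘ φ-lift a))
    ⟦⟧-resp pow-rel            = lift^N≈ιz

    φ-normal : ∀ a k → φ ⟦ gen a · ŝpow k ⟧ ≈ₘ k
    φ-normal a k = ≈ₘ-trans (φ-⟦⟧ (gen a · ŝpow k)) (≡⇒≈ₘ (φPres-ŝpow k))

    ⟦⟧-injective : ∀ {x y} → ⟦ x ⟧ ≈ ⟦ y ⟧ → x ∼ y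
    ⟦⟧-injective {x} {y} ⟦x⟧≈⟦y⟧ with reduced-normal x | reduced-normal y
    ... | a , k , k<N , x∼ | b , m , m<N , y∼ = equal-exponents (≈ₘ∧<⇒≡ k<N m<N k≈ₘm) normal≈
      where
      normal≈ : ⟦ gen a · ŝpow k ⟧ ≈ ⟦ gen b · ŝpow m ⟧
      normal≈ = trans (sym (⟦⟧-resp x∼)) (trans ⟦x⟧≈⟦y⟧ (⟦⟧-resp y∼))
      k≈ₘm : k ≈ₘ m
      k≈ₘm = ≈ₘ-trans (≈ₘ-sym (φ-normal a k)) (≈ₘ-trans (φ-resp normal≈) (φ-normal b m))
      equal-exponents : k ≡ m → ι a ∙ lift^ k ≈ ι b ∙ lift^ m → x ∼ y
      equal-exponents ≡.refl ιa∙sᵏ≈ιb∙sᵏ = ∼-trans x∼ (∼-trans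
        (w-·-cong (gen-cong (ι.injective (∙-cancelʳ (lift^ k) (ι a) (ι b) ιa∙sᵏ≈ιb∙sᵏ))) ∼-refl)
        (∼-sym y∼))

    coset-kernel : ∀ x → ModEq N (φ (x ∙ lift^ (φ x) ⁻¹)) 0
    coset-kernel x = ≈ₘ⇒ModEq (begin
      φ (x ∙ lift^ (φ x) ⁻¹)                ≈⟨ φ-homo x _ ⟩
      φ x + φ (lift^ (φ x) ⁻¹)              ≈⟨ +-cong-≈ₘ (≈ₘ-refl {φ x}) (φ-⁻¹ (lift^ (φ x))) ⟩
      φ x + (N ∸ 1) * φ (lift^ (φ x))       ≈⟨ +-cong-≈ₘ (≈ₘ-refl {φ x}) (*-congˡ-≈ₘ (N ∸ 1) (φ-lift^ (φ x))) ⟩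
      φ x + (N ∸ 1) * φ x                   ≈⟨ x+[N∸1]x≈ₘ0 (φ x) ⟩
      0                                     ∎)
      where open ≈ₘ-Reasoning

    -- Opaque so that unfolding the chosen kernel preimage does not swamp the checks below.
    opaque
      ψ : Carrier → Word
      ψ x = gen (proj₁ (ker⊆im _ (coset-kernel x))) · ŝpow (φ x)

      ⟦ψ⟧ : ∀ x → ⟦ ψ x ⟧ ≈ x
      ⟦ψ⟧ x = trans (∙-congʳ (proj₂ (ker⊆im _ (coset-kernel x)))) (cancelʳ (inverseˡ (lift^ (φ x))) x)

      φPres-ψ : ∀ x → φPres (ψ x) ≡ φ x
      φPres-ψ x = φPres-ŝpow (φ x)

    ψ-cong : ∀ {x y} → x ≈ y → ψ x ∼ ψ y
    ψ-cong {x} {y} x≈y = ⟦⟧-injective {ψ x} {ψ y} (trans (⟦ψ⟧ x) (trans x≈y (sym (⟦ψ⟧ y))))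

    ψ-homo : ∀ x y → ψ (x ∙ y) ∼ ψ x · ψ y
    ψ-homo x y = ⟦⟧-injective {ψ (x ∙ y)} {ψ x · ψ y} (trans (⟦ψ⟧ (x ∙ y)) (sym (∙-cong (⟦ψ⟧ x) (⟦ψ⟧ y))))

    ψ-ε : ψ ε ∼ e
    ψ-ε = ⟦⟧-injective {ψ ε} {e} (⟦ψ⟧ ε)

    ψ-⁻¹ : ∀ x → ψ (x ⁻¹) ∼ inv (ψ x)
    ψ-⁻¹ x = ⟦⟧-injective {ψ (x ⁻¹)} {inv (ψ x)} (trans (⟦ψ⟧ (x ⁻¹)) (sym (⁻¹-cong (⟦ψ⟧ x))))

    ψ-injective : ∀ {x y} → ψ x ∼ ψ y → x ≈ y
    ψ-injective {x} {y} ψx∼ψy = trans (sym (⟦ψ⟧ x)) (trans (⟦⟧-resp ψx∼ψy) (⟦ψ⟧ y))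

    ψ-surjective : ∀ w → ∃ λ x → ∀ {x′} → x′ ≈ x → ψ x′ ∼ w
    ψ-surjective w = ⟦ w ⟧ , λ {x′} x′≈⟦w⟧ → ⟦⟧-injective {ψ x′} {w} (trans (⟦ψ⟧ x′) x′≈⟦w⟧)

    iso : IsoToPres Ĝ φ z
    iso = ψ , record
      { isGroupMonomorphism = record
        { isGroupHomomorphism = record
          { isMonoidHomomorphism = record
            { isMagmaHomomorphism = record
              { isRelHomomorphism = record { cong = ψ-cong }
              ; homo = ψ-homo }
            ; ε-homo = ψ-ε }
          ; ⁻¹-homo = ψ-⁻¹ }
        ; injective = ψ-injective }
      ; surjective = ψ-surjective }
      , λ x → ≈ₘ⇒ModEq (≡⇒≈ₘ (φPres-ψ x))

proposition3p2 : (p n : ℕ) → Prime p → (M : FpGModule p n) →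
    ModuleNotions.IsFinite M →
    (r : ℕ) (α : Fin r → FpGModule.Carrier M) → ModuleNotions.IsCyclicDecomposition M r α →
    (ℓα : Fin r → ℕ) → (∀ i → ModuleNotions.HasDim M (ModuleNotions.InCyclic M (α i)) (ℓα i)) →
    {c ℓ : Level} (Ĝ : Group c ℓ) (ι : FpGModule.Carrier M → Group.Carrier Ĝ) (φ : Group.Carrier Ĝ → ℕ) →
    ModuleNotions.IsEmbeddingProblem M Ĝ ι φ →
    ∃ λ (cv : Fin r → Fin p) → ModuleNotions.IsoToPres M Ĝ φ (ModuleNotions.zVec M α ℓα cv)
proposition3p2 p n pr M _ r α decomposition ℓα dims Ĝ ι φ emb =
  cv , Isomorphism.iso (zVec α ℓα cv) (trans (sym ι-a₀) (ι.⟦⟧-cong a₀≈zVec))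
  where
  open ModuleNotions M using (zVec)
  open EmbeddingProblemTheory M pr Ĝ ι φ emb using (a₀; σ-a₀; ι-a₀; module Isomorphism; module ι)
  open Group Ĝ using (trans; sym)
  fixed : ∃ λ (cv : Fin r → Fin p) → FpGModule._≈_ M a₀ (zVec α ℓα cv)
  fixed = FpGModuleTheory.fixed⇒zVec M pr decomposition dims a₀ σ-a₀
  cv : Fin r → Fin p
  cv = proj₁ fixed
  a₀≈zVec : FpGModule._≈_ M a₀ (zVec α ℓα cv)
  a₀≈zVec = proj₂ fixed
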